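{- Let $\lambda$ be a strict partition of length $r$ and $f=(f_1,\dots,f_r)$ a sequence of nonnegative integers. For a strict partition $\mu\subset\lambda$ (written $\mu=(\mu_1,\dots,\mu_r)$ padded with zeros) let $\bar\mu=(\bar\mu_1,\dots,\bar\mu_r)$ with $\bar\mu_i=\mu_i+i-1$, and similarly $\bar\lambda_i=\lambda_i+i-1$. Assume that, if $r\geq2$, then $\lambda_{r-1}>f_{r-1}$ or $\lambda_r>f_r$. Then \[Q_{\lambda,f}(x;z|b)=\sum_{\mu}Q_\mu(x|b)\cdot\widetilde s_{\bar\lambda/\bar\mu,f}(z|\mathbf b)^\star,\] the sum over strict partitions $\mu\subset\lambda$ such that $\bar\mu$ is a partition (weakly decreasing), where $\star$ is the substitution $b_{ -i}\mapsto -b_{i+1}$ for all $i\geq 0$.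
   Context: Alphabet $1'<1<2'<2<\cdots<1^\circ<2^\circ<\cdots$ (unmarked, primed, circled). $\operatorname{MST}(\lambda,f)$: fillings of the shifted diagram of $\lambda$ (row $i$ in columns $i,\dots,i+\lambda_i-1$) with entries weakly increasing along rows and columns, unmarked numbers strictly increasing in columns, primed numbers strictly increasing in rows, circled numbers strictly increasing in rows, entries in row $i$ at most $f_i^\circ$. With $r(e),c(e)$ the row/column of an entry and the convention $b_{ -i}=-b_{i+1}$ ($i\geq0$), $Q_{\lambda,f}(x;z|b)=\sum_{T}\prod_{k\in T}(x_k+b_{c(k)-r(k)})\prod_{k'\in T}(x_k-b_{c(k')-r(k')})\prod_{k^\circ\in T}(z_k+b_{k+r(k^\circ)-c(k^\circ)})$ over $T\in\operatorname{MST}(\lambda,f)$. $Q_\mu(x|b)$ (Ivanov's factorial $Q$-function) is $Q_{\mu,(0,\dots,0)}$, which does not involve $z$; $Q_\varnothing=1$. Row-strict flagged skew factorial Schur polynomial: let $\mathbf b=(b_i)_{i\in\mathbb Z}$ be independent indeterminates. For partitions $\nu\subset\kappa$ of length at most $r$ and a flagging $g=(g_1,\dots,g_r)$ of nonnegative integers, $\operatorname{SST}^*(\kappa/\nu,g)$ is the set of fillings of the skew Young diagram $\kappa/\nu$ by positive integers, strictly increasing left to right in rows, weakly increasing top to bottom in columns, with entries in row $i$ at most $g_i$. Then $\widetilde s_{\kappa/\nu,g}(z|\mathbf b)=\sum_{T\in\operatorname{SST}^*(\kappa/\nu,g)}\prod_{e\in T}(z_{|e|}+b_{|e|+r(e)-c(e)})$,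 where $|e|$ is the entry value (here no relation among the $b_i$ is assumed before applying $\star$). -}

module Defs where

open import Data.Bool using (Bool; true; false; _∧_; _∨_; not; if_then_else_)
open import Data.Nat using (ℕ; zero; suc; _+_; _*_; _∸_; _<_; _≡ᵇ_; _<ᵇ_; _≤ᵇ_)
open import Data.Integer as ℤ using (ℤ; +_; -[1+_])
open import Data.List.Base using (List; []; _∷_; map; concatMap; foldr; zip; length; _++_)
open import Data.Vec as Vec using (Vec; []; _∷_)
open import Data.Product using (_×_; _,_)
open import Data.Sum using (_⊎_)
open import Data.Unit using (⊤)
open import Algebra.Bundles using (CommutativeRing)

range : ℕ → ℕ → List ℕ
range a zero = []
range a (suc m) = a ∷ range (suc a) m

allWords : {A : Set} → List A → ℕ → List (List A)
allWords A zero = [] ∷ []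
allWords A (suc m) = concatMap (λ a → map (a ∷_) (allWords A m)) A

all : {A : Set} → (A → Bool) → List A → Bool
all p [] = true
all p (a ∷ as) = p a ∧ all p as

StrictPartition : List ℕ → Set
StrictPartition [] = ⊤
StrictPartition (a ∷ []) = 0 < a
StrictPartition (a ∷ b ∷ t) = (b < a) × StrictPartition (b ∷ t)

paddedStrictᵇ : List ℕ → Bool
paddedStrictᵇ [] = true
paddedStrictᵇ (a ∷ []) = true
paddedStrictᵇ (a ∷ b ∷ t) = ((b <ᵇ a) ∨ ((a ≡ᵇ 0) ∧ (b ≡ᵇ 0))) ∧ paddedStrictᵇ (b ∷ t)

isPartitionᵇ : List ℕ → Bool
isPartitionᵇ [] = true
isPartitionᵇ (a ∷ []) = true
isPartitionᵇ (a ∷ b ∷ t) = (b ≤ᵇ a) ∧ isPartitionᵇ (b ∷ t)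

-- bar: the i-th part (1-indexed) v_i becomes v_i + i - 1
barFrom : ∀ {r} → ℕ → Vec ℕ r → Vec ℕ r
barFrom i [] = []
barFrom i (a ∷ v) = (a + i) ∷ barFrom (suc i) v

bar : ∀ {r} → Vec ℕ r → Vec ℕ r
bar = barFrom 0

boundedVecs : ∀ {r} → Vec ℕ r → List (Vec ℕ r)
boundedVecs [] = [] ∷ []
boundedVecs (l ∷ ls) = concatMap (λ a → map (a ∷_) (boundedVecs ls)) (range 0 (suc l))

LastTwo : ∀ {r} → Vec ℕ r → Vec ℕ r → Set
LastTwo [] [] = ⊤
LastTwo (a ∷ []) (fa ∷ []) = ⊤
LastTwo (a ∷ b ∷ []) (fa ∷ fb ∷ []) = (fa < a) ⊎ (fb < b)
LastTwo (a ∷ b ∷ c ∷ t) (_ ∷ fs) = LastTwo (b ∷ c ∷ t) fs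

-- Cells: (row, column, row bound from the flagging); rows/columns 1-indexed

Cell : Set
Cell = ℕ × ℕ × ℕ

shiftedCellsFrom : ∀ {r} → ℕ → Vec ℕ r → Vec ℕ r → List Cell
shiftedCellsFrom i [] [] = []
shiftedCellsFrom i (l ∷ ls) (g ∷ gs) =
  map (λ j → i , j , g) (range i l) ++ shiftedCellsFrom (suc i) ls gs

shiftedCells : ∀ {r} → Vec ℕ r → Vec ℕ r → List Cell
shiftedCells = shiftedCellsFrom 1

skewCellsFrom : ∀ {r} → ℕ → Vec ℕ r → Vec ℕ r → Vec ℕ r → List Cell
skewCellsFrom i [] [] [] = []
skewCellsFrom i (k ∷ ks) (n ∷ ns) (g ∷ gs) =
  map (λ j → i , j , g) (range (suc n) (k ∸ n)) ++ skewCellsFrom (suc i) ks ns gs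

skewCells : ∀ {r} → Vec ℕ r → Vec ℕ r → Vec ℕ r → List Cell
skewCells = skewCellsFrom 1

-- Marked alphabet 1' < 1 < 2' < 2 < ... < 1° < 2° < ...

data Entry : Set where
  unm  : ℕ → Entry
  pr   : ℕ → Entry
  circ : ℕ → Entry

key : ℕ → Entry → ℕ
key _ (pr k) = 2 * k
key _ (unm k) = 2 * k + 1
key _ (circ k) = k

_≤E_ : Entry → Entry → Bool
circ a ≤E circ b = a ≤ᵇ b
circ a ≤E unm b = false
circ a ≤E pr b = false
unm a ≤E circ b = true
pr a ≤E circ b = true
unm a ≤E unm b = key 0 (unm a) ≤ᵇ key 0 (unm b)
unm a ≤E pr b = key 0 (unm a) ≤ᵇ key 0 (pr b)
pr a ≤E unm b = key 0 (pr a) ≤ᵇ key 0 (unm b)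
pr a ≤E pr b = key 0 (pr a) ≤ᵇ key 0 (pr b)

_==E_ : Entry → Entry → Bool
unm a ==E unm b = a ≡ᵇ b
pr a ==E pr b = a ≡ᵇ b
circ a ==E circ b = a ≡ᵇ b
_ ==E _ = false

isUnm isPr isCirc : Entry → Bool
isUnm (unm _) = true
isUnm _ = false
isPr (pr _) = true
isPr _ = false
isCirc (circ _) = true
isCirc _ = false

alphabet : ℕ → ℕ → List Entry
alphabet n F = map unm (range 1 n) ++ map pr (range 1 n) ++ map circ (range 1 F)

Filling : Set
Filling = List (Cell × Entry)

mstRowOK : Cell × Entry → Bool
mstRowOK ((_ , _ , g) , e) = e ≤E circ g

mstPairOK : Cell × Entry → Cell × Entry → Bool
mstPairOK ((i , j , _) , e) ((i' , j' , _) , e') =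
  (not ((i ≡ᵇ i') ∧ (j <ᵇ j')) ∨ ((e ≤E e') ∧ not ((isPr e ∨ isCirc e) ∧ (e ==E e'))))
  ∧ (not ((j ≡ᵇ j') ∧ (i <ᵇ i')) ∨ ((e ≤E e') ∧ not (isUnm e ∧ (e ==E e'))))

isMST : Filling → Bool
isMST T = all mstRowOK T ∧ all (λ p → all (mstPairOK p) T) T

mstCandidates : ∀ {r} → ℕ → Vec ℕ r → Vec ℕ r → List Filling
mstCandidates n la f =
  map (zip (shiftedCells la f))
      (allWords (alphabet n (Vec.sum f)) (length (shiftedCells la f)))

SFilling : Set
SFilling = List (Cell × ℕ)

sstRowOK : Cell × ℕ → Bool
sstRowOK ((_ , _ , g) , e) = (1 ≤ᵇ e) ∧ (e ≤ᵇ g)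

sstPairOK : Cell × ℕ → Cell × ℕ → Bool
sstPairOK ((i , j , _) , e) ((i' , j' , _) , e') =
  (not ((i ≡ᵇ i') ∧ (j <ᵇ j')) ∨ (e <ᵇ e'))
  ∧ (not ((j ≡ᵇ j') ∧ (i <ᵇ i')) ∨ (e ≤ᵇ e'))

isSST : SFilling → Bool
isSST T = all sstRowOK T ∧ all (λ p → all (sstPairOK p) T) T

sstCandidates : ∀ {r} → Vec ℕ r → Vec ℕ r → Vec ℕ r → List SFilling
sstCandidates κ ν g =
  map (zip (skewCells κ ν g))
      (allWords (range 1 (Vec.sum g)) (length (skewCells κ ν g)))

module Poly {c ℓ} (R : CommutativeRing c ℓ) where
  open CommutativeRing R hiding (_+_; _*_)
  open CommutativeRing R using () renaming (_+_ to _⊕_; _*_ to _⊗_)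

  sumL : List Carrier → Carrier
  sumL = foldr _⊕_ 0#

  prodL : List Carrier → Carrier
  prodL = foldr _⊗_ 1#

  -- b : the independent indeterminates b_1, b_2, ... (b 0 is unused);
  -- bZ extends to all integer indices by b_{-i} = - b_{i+1} (i ≥ 0)
  bZ : (ℕ → Carrier) → ℤ → Carrier
  bZ b (+ zero) = - b 1
  bZ b (+ suc m) = b (suc m)
  bZ b -[1+ m ] = - b (suc (suc m))

  mstWeight : (ℕ → Carrier) → (ℕ → Carrier) → (ℕ → Carrier) → Cell × Entry → Carrier
  mstWeight x z b ((i , j , _) , unm k) = x k ⊕ bZ b ((+ j) ℤ.- (+ i))
  mstWeight x z b ((i , j , _) , pr k) = x k ⊕ (- bZ b ((+ j) ℤ.- (+ i)))
  mstWeight x z b ((i , j , _) , circ k) = z k ⊕ bZ b ((+ k) ℤ.+ (+ i) ℤ.- (+ j))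

  Qλf : ∀ {r} → ℕ → (x z b : ℕ → Carrier) → Vec ℕ r → Vec ℕ r → Carrier
  Qλf n x z b la f =
    sumL (map (λ T → if isMST T then prodL (map (mstWeight x z b) T) else 0#)
              (mstCandidates n la f))

  Qμ : ∀ {r} → ℕ → (x b : ℕ → Carrier) → Vec ℕ r → Carrier
  Qμ {r} n x b μ = Qλf n x (λ _ → 0#) b μ (Vec.replicate r 0)

  sTilde : ∀ {r} → (z : ℕ → Carrier) → (β : ℤ → Carrier) → Vec ℕ r → Vec ℕ r → Vec ℕ r → Carrier
  sTilde z β κ ν g =
    sumL (map (λ T → if isSST T
                     then prodL (map (λ { ((i , j , _) , e) → z e ⊕ β ((+ e) ℤ.+ (+ i) ℤ.- (+ j)) }) T)
                     else 0#)
              (sstCandidates κ ν g))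

  -- the star substitution b_{-i} ↦ -b_{i+1}: evaluate at β = bZ b
  sTildeStar : ∀ {r} → (z b : ℕ → Carrier) → Vec ℕ r → Vec ℕ r → Vec ℕ r → Carrier
  sTildeStar z b = sTilde z (bZ b)

  admissibleμ : ∀ {r} → Vec ℕ r → Bool
  admissibleμ μ = paddedStrictᵇ (Vec.toList μ) ∧ isPartitionᵇ (Vec.toList (bar μ))

  expansion : ∀ {r} → ℕ → (x z b : ℕ → Carrier) → Vec ℕ r → Vec ℕ r → Carrier
  expansion n x z b la f =
    sumL (map (λ μ → if admissibleμ μ
                     then Qμ n x b μ ⊗ sTildeStar z b (bar la) (bar μ) f
                     else 0#)
              (boundedVecs la))

-- Expand Q_{λ,f} as a sum over all words, one letter per cell of the shifted diagram, from the
-- alphabet of plain (unmarked or primed) and circled letters. Circled letters exceed plain ones, so a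
-- word contributes only if in each row i its first μ_i letters are plain and the remaining λ_i - μ_i
-- circled. The plain cells then form the shifted diagram of μ and the circled cells the skew diagram
-- λ̄/μ̄, the weight factors, and the MST condition splits into the MST condition on the plain part
-- (giving Q_μ), the row-strict condition on the circled part (giving s̃) and cross conditions between
-- them. If μ is strict and μ̄ a partition, the cross conditions hold automatically. If μ is not strict,
-- some circled cell lies directly above a plain one. If μ is strict but μ̄ is not a partition, μ ends
-- in two zeros, and the hypothesis on the last two rows makes one of them longer than the number of
-- circled values its flag allows, so no row-strict filling exists.

module Submission where

open import Defs
open import Data.Nat using (ℕ)
open import Data.Vec using (Vec; toList)
open import Algebra.Bundles using (CommutativeRing)

open import Function using (_∘_; Equivalence)
open import Data.Bool using (Bool; true; false; T; _∧_; _∨_; not; if_then_else_)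
open import Data.Bool.Properties using (∧-assoc; ∧-comm; ∧-zeroʳ; ∧-identityʳ; ∨-zeroʳ; T-≡; ¬-not)
open import Data.Nat using (zero; suc; _+_; _∸_; _≤_; _<_; z≤n; s≤s; _≡ᵇ_; _<ᵇ_; _≤ᵇ_)
import Data.Nat.Properties as ℕP
open import Data.Vec.Relation.Unary.All as VecAll using ([]; _∷_)
open import Data.List using (List; []; _∷_; map; concatMap; zip; length; _++_; take; drop)
open import Data.List.Properties
  using (∷-injectiveˡ; ∷-injectiveʳ; map-++; map-∘; ++-assoc; ++-identityʳ; length-++; length-map; length-take; take-map; drop-map; length-drop)
open import Data.List.Relation.Unary.All as All using (All; []; _∷_)
open import Data.List.Relation.Unary.All.Properties as Allₚ using ()
open import Data.List.Relation.Unary.Any using (here; there)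
open import Data.List.Membership.Propositional using (_∈_)
open import Data.List.Membership.Propositional.Properties using (∈-++⁺ˡ; ∈-++⁺ʳ)
open import Data.List.Relation.Ternary.Interleaving.Propositional as Inter
  using (Interleaving; []; consˡ; consʳ)
import Data.List.Relation.Ternary.Interleaving.Properties as Interₚ
import Data.List.Relation.Binary.Pointwise as ListPointwise
open import Data.Vec.Relation.Binary.Pointwise.Inductive using (Pointwise; []; _∷_)
open import Data.Vec as Vec using ([]; _∷_)
open import Data.Product using (∃; _×_; _,_; proj₁; proj₂; map₂)
open import Data.Sum using (_⊎_; inj₁; inj₂)
open import Data.Empty using (⊥; ⊥-elim)
open import Data.Unit using (⊤; tt)
import Data.Unit.Polymorphic as ⊤ℓ
import Data.Integer as ℤ
open import Relation.Binary.PropositionalEquality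
  using (_≡_; refl; cong; cong₂; sym; trans; subst; module ≡-Reasoning)

≡true⇒T : ∀ {b} → b ≡ true → T b
≡true⇒T = Equivalence.from T-≡

T⇒≡true : ∀ {b} → T b → b ≡ true
T⇒≡true = Equivalence.to T-≡

∧≡true⇒ : ∀ {a b} → (a ∧ b) ≡ true → a ≡ true × b ≡ true
∧≡true⇒ {true} {true} _ = refl , refl

∨≡false⇒ : ∀ {a b} → (a ∨ b) ≡ false → a ≡ false × b ≡ false
∨≡false⇒ {false} {false} _ = refl , refl

∧≡false : ∀ {a b} → (a ≡ true → b ≡ false) → (a ∧ b) ≡ false
∧≡false {false} _ = refl
∧≡false {true} h = h refl

∧-∧-false₂ : ∀ a c d {b} → b ≡ false → ((a ∧ b) ∧ (c ∧ d)) ≡ false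
∧-∧-false₂ a c d refl = cong (_∧ (c ∧ d)) (∧-zeroʳ a)

∧-∧-false₄ : ∀ a b c {d} → d ≡ false → ((a ∧ b) ∧ (c ∧ d)) ≡ false
∧-∧-false₄ a b c refl = trans (cong ((a ∧ b) ∧_) (∧-zeroʳ c)) (∧-zeroʳ (a ∧ b))

true≢false : true ≡ false → ⊥
true≢false ()

<⇒<ᵇ≡true : ∀ {m n} → m < n → (m <ᵇ n) ≡ true
<⇒<ᵇ≡true = T⇒≡true ∘ ℕP.<⇒<ᵇ

<ᵇ≡true⇒< : ∀ {m n} → (m <ᵇ n) ≡ true → m < n
<ᵇ≡true⇒< {m} {n} = ℕP.<ᵇ⇒< m n ∘ ≡true⇒T

≥⇒<ᵇ≡false : ∀ {m n} → n ≤ m → (m <ᵇ n) ≡ false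
≥⇒<ᵇ≡false n≤m = ¬-not (ℕP.≤⇒≯ n≤m ∘ <ᵇ≡true⇒<)

<ᵇ≡false⇒≥ : ∀ {m n} → (m <ᵇ n) ≡ false → n ≤ m
<ᵇ≡false⇒≥ e = ℕP.≮⇒≥ (λ m<n → true≢false (trans (sym (<⇒<ᵇ≡true m<n)) e))

≤⇒≤ᵇ≡true : ∀ {m n} → m ≤ n → (m ≤ᵇ n) ≡ true
≤⇒≤ᵇ≡true = T⇒≡true ∘ ℕP.≤⇒≤ᵇ

≤ᵇ≡true⇒≤ : ∀ {m n} → (m ≤ᵇ n) ≡ true → m ≤ n
≤ᵇ≡true⇒≤ {m} {n} = ℕP.≤ᵇ⇒≤ m n ∘ ≡true⇒T

≡ᵇ-refl : ∀ m → (m ≡ᵇ m) ≡ true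
≡ᵇ-refl m = T⇒≡true (ℕP.≡⇒≡ᵇ m m refl)

≡ᵇ≡true⇒≡ : ∀ {m n} → (m ≡ᵇ n) ≡ true → m ≡ n
≡ᵇ≡true⇒≡ {m} {n} = ℕP.≡ᵇ⇒≡ m n ∘ ≡true⇒T

≢⇒≡ᵇ≡false : ∀ {m n} → (m ≡ n → ⊥) → (m ≡ᵇ n) ≡ false
≢⇒≡ᵇ≡false m≢n = ¬-not (m≢n ∘ ≡ᵇ≡true⇒≡)

≤ᵇ∧≢ᵇ≡<ᵇ : ∀ m n → ((m ≤ᵇ n) ∧ not (m ≡ᵇ n)) ≡ (m <ᵇ n)
≤ᵇ∧≢ᵇ≡<ᵇ zero zero = refl
≤ᵇ∧≢ᵇ≡<ᵇ zero (suc n) = refl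
≤ᵇ∧≢ᵇ≡<ᵇ (suc m) zero = refl
≤ᵇ∧≢ᵇ≡<ᵇ (suc zero) (suc n) = ≤ᵇ∧≢ᵇ≡<ᵇ zero n
≤ᵇ∧≢ᵇ≡<ᵇ (suc (suc m)) (suc n) = ≤ᵇ∧≢ᵇ≡<ᵇ (suc m) n

∧-exchange : ∀ a b c → (a ∧ (b ∧ c)) ≡ (b ∧ (a ∧ c))
∧-exchange true b c = refl
∧-exchange false true c = refl
∧-exchange false false c = refl

all-++ : ∀ {A : Set} (p : A → Bool) xs ys → all p (xs ++ ys) ≡ (all p xs ∧ all p ys)
all-++ p [] ys = refl
all-++ p (x ∷ xs) ys = trans (cong (p x ∧_) (all-++ p xs ys)) (sym (∧-assoc (p x) _ _))

all-∧ : ∀ {A : Set} (p q : A → Bool) xs → all (λ x → p x ∧ q x) xs ≡ (all p xs ∧ all q xs)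
all-∧ p q [] = refl
all-∧ p q (x ∷ xs) rewrite all-∧ p q xs with p x | q x
... | true | true = refl
... | true | false = sym (∧-zeroʳ (all p xs))
... | false | _ = refl

all-cong : ∀ {A : Set} {P : A → Set} {p q : A → Bool} {xs} →
           All P xs → (∀ {x} → P x → p x ≡ q x) → all p xs ≡ all q xs
all-cong [] e = refl
all-cong (px ∷ pxs) e = cong₂ _∧_ (e px) (all-cong pxs e)

all-cong′ : ∀ {A : Set} {p q : A → Bool} xs → (∀ x → p x ≡ q x) → all p xs ≡ all q xs
all-cong′ xs e = all-cong (All.universal (λ _ → tt) xs) (λ {x} _ → e x)

all-map : ∀ {A B : Set} (p : B → Bool) (f : A → B) xs → all p (map f xs) ≡ all (p ∘ f) xs
all-map p f [] = refl
all-map p f (x ∷ xs) = cong (p (f x) ∧_) (all-map p f xs)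

All⇒all≡true : ∀ {A : Set} {P : A → Set} {p : A → Bool} {xs} →
               All P xs → (∀ {x} → P x → p x ≡ true) → all p xs ≡ true
All⇒all≡true [] e = refl
All⇒all≡true (px ∷ pxs) e rewrite e px = All⇒all≡true pxs e

all≡true⇒∈ : ∀ {A : Set} {p : A → Bool} {x} xs → all p xs ≡ true → x ∈ xs → p x ≡ true
all≡true⇒∈ {p = p} (y ∷ xs) h (here refl) = proj₁ (∧≡true⇒ {p y} h)
all≡true⇒∈ {p = p} (y ∷ xs) h (there x∈xs) = all≡true⇒∈ xs (proj₂ (∧≡true⇒ {p y} h)) x∈xs

∈⇒all≡false : ∀ {A : Set} {p : A → Bool} {x} xs → x ∈ xs → p x ≡ false → all p xs ≡ false
∈⇒all≡false (y ∷ xs) (here refl) e rewrite e = refl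
∈⇒all≡false {p = p} (y ∷ xs) (there x∈xs) e =
  trans (cong (p y ∧_) (∈⇒all≡false xs x∈xs e)) (∧-zeroʳ (p y))

all-interleaving : ∀ {A : Set} (p : A → Bool) {xs ys zs} → Interleaving xs ys zs →
                   all p zs ≡ (all p xs ∧ all p ys)
all-interleaving p [] = refl
all-interleaving p {x ∷ xs} {ys} (consˡ i) =
  trans (cong (p x ∧_) (all-interleaving p i)) (sym (∧-assoc (p x) (all p xs) (all p ys)))
all-interleaving p {xs} {y ∷ ys} (consʳ i) =
  trans (cong (p y ∧_) (all-interleaving p i)) (∧-exchange (p y) (all p xs) (all p ys))

zip-[]ʳ : ∀ {A B : Set} (xs : List A) → zip {B = B} xs [] ≡ []
zip-[]ʳ [] = refl
zip-[]ʳ (x ∷ xs) = refl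

zip-++ˡ : ∀ {A B : Set} (xs ys : List A) (w : List B) →
          zip (xs ++ ys) w ≡ zip xs w ++ zip ys (drop (length xs) w)
zip-++ˡ [] ys w = refl
zip-++ˡ (x ∷ xs) ys [] = sym (zip-[]ʳ ys)
zip-++ˡ (x ∷ xs) ys (b ∷ w) = cong ((x , b) ∷_) (zip-++ˡ xs ys w)

zip-++ : ∀ {A B : Set} (xs ys : List A) (v w : List B) → length xs ≡ length v →
         zip (xs ++ ys) (v ++ w) ≡ zip xs v ++ zip ys w
zip-++ [] ys [] w e = refl
zip-++ (x ∷ xs) ys (b ∷ v) w e = cong ((x , b) ∷_) (zip-++ xs ys v w (ℕP.suc-injective e))

zip-take : ∀ {A B : Set} (xs : List A) (w : List B) {k} → length xs ≡ k → zip xs (take k w) ≡ zip xs w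
zip-take [] w refl = refl
zip-take (x ∷ xs) [] refl = refl
zip-take (x ∷ xs) (b ∷ w) refl = cong ((x , b) ∷_) (zip-take xs w refl)

zip-map₂ : ∀ {A B B′ : Set} (f : B → B′) (xs : List A) (w : List B) →
           zip xs (map f w) ≡ map (map₂ f) (zip xs w)
zip-map₂ f [] w = refl
zip-map₂ f (x ∷ xs) [] = refl
zip-map₂ f (x ∷ xs) (b ∷ w) = cong (_ ∷_) (zip-map₂ f xs w)

take-++ : ∀ {A : Set} (u v : List A) {a} → length u ≡ a → take a (u ++ v) ≡ u
take-++ [] v refl = refl
take-++ (x ∷ u) v refl = cong (x ∷_) (take-++ u v refl)

drop-++ : ∀ {A : Set} (u v : List A) {a} → length u ≡ a → drop a (u ++ v) ≡ v
drop-++ [] v refl = refl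
drop-++ (x ∷ u) v refl = drop-++ u v refl

length-take-≤ : ∀ {A : Set} k (w : List A) → k ≤ length w → length (take k w) ≡ k
length-take-≤ k w k≤ = trans (length-take k w) (ℕP.m≤n⇒m⊓n≡m k≤)

length≡+⇒drop : ∀ {A : Set} a k (w : List A) → length w ≡ a + k →
                  a ≤ length w × length (drop a w) ≡ k
length≡+⇒drop a k w e =
  subst (a ≤_) (sym e) (ℕP.m≤m+n a k) ,
  trans (length-drop a w) (trans (cong (_∸ a) e) (ℕP.m+n∸m≡n a k))

All-zip⁺ʳ : ∀ {A B : Set} {P : B → Set} (xs : List A) {w : List B} →
            All P w → All (P ∘ proj₂) (zip xs w)
All-zip⁺ʳ [] _ = []
All-zip⁺ʳ (x ∷ xs) [] = []
All-zip⁺ʳ (x ∷ xs) (pb ∷ pw) = pb ∷ All-zip⁺ʳ xs pw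

All-zip⁺ : ∀ {A B : Set} {P : A → Set} {Q : B → Set} {xs : List A} {w : List B} →
           All P xs → All Q w → All (λ p → P (proj₁ p) × Q (proj₂ p)) (zip xs w)
All-zip⁺ [] _ = []
All-zip⁺ (px ∷ pxs) [] = []
All-zip⁺ (px ∷ pxs) (qb ∷ qw) = (px , qb) ∷ All-zip⁺ pxs qw

All-map-image : ∀ {A B : Set} (h : A → B) (w : List A) → All (λ y → ∃ λ x → y ≡ h x) (map h w)
All-map-image h [] = []
All-map-image h (x ∷ w) = (x , refl) ∷ All-map-image h w

row col : Cell → ℕ
row (i , _ , _) = i
col (_ , j , _) = j

rowCells : (i s m g : ℕ) → List Cell
rowCells i s m g = map (λ j → i , j , g) (range s m)

length-range : ∀ s m → length (range s m) ≡ m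
length-range s zero = refl
length-range s (suc m) = cong suc (length-range (suc s) m)

length-rowCells : ∀ i s m g → length (rowCells i s m g) ≡ m
length-rowCells i s m g = trans (length-map _ (range s m)) (length-range s m)

range-++ : ∀ s a k → range s (a + k) ≡ range s a ++ range (s + a) k
range-++ s zero k = cong (λ s′ → range s′ k) (sym (ℕP.+-identityʳ s))
range-++ s (suc a) k =
  cong (s ∷_) (trans (range-++ (suc s) a k) (cong (λ s′ → range (suc s) a ++ range s′ k) (sym (ℕP.+-suc s a))))

rowCells-++ : ∀ i s a m g → a ≤ m → rowCells i s m g ≡ rowCells i s a g ++ rowCells i (s + a) (m ∸ a) g
rowCells-++ i s a m g a≤m =
  trans (cong (λ k → rowCells i s k g) (sym (ℕP.m+[n∸m]≡n a≤m)))
        (trans (cong (map _) (range-++ s a (m ∸ a))) (map-++ _ (range s a) _))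

All-range : ∀ s m → All (λ j → s ≤ j × j < s + m) (range s m)
All-range s zero = []
All-range s (suc m) =
  (ℕP.≤-refl , subst (s <_) (sym (ℕP.+-suc s m)) (ℕP.m≤m+n (suc s) m)) ∷
  All.map (λ {j} (s<j , j<) → ℕP.≤-trans (ℕP.n≤1+n s) s<j , subst (j <_) (sym (ℕP.+-suc s m)) j<)
          (All-range (suc s) m)

All-rowCells : ∀ i s m g → All (λ c → row c ≡ i × s ≤ col c × col c < s + m) (rowCells i s m g)
All-rowCells i s m g = Allₚ.map⁺ (All.map (λ (s≤j , j<) → refl , s≤j , j<) (All-range s m))

All-shiftedCells-row≥ : ∀ {r} s (μ g : Vec ℕ r) → All (λ c → s ≤ row c) (shiftedCellsFrom s μ g)
All-shiftedCells-row≥ s [] [] = []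
All-shiftedCells-row≥ s (a ∷ μ) (g ∷ gs) =
  Allₚ.++⁺ (Allₚ.map⁺ (All.universal (λ _ → ℕP.≤-refl) (range s a)))
           (All.map (ℕP.≤-trans (ℕP.n≤1+n s)) (All-shiftedCells-row≥ (suc s) μ gs))

All-skewCells-row≥ : ∀ {r} s (κ ν g : Vec ℕ r) → All (λ c → s ≤ row c) (skewCellsFrom s κ ν g)
All-skewCells-row≥ s [] [] [] = []
All-skewCells-row≥ s (k ∷ κ) (a ∷ ν) (g ∷ gs) =
  Allₚ.++⁺ (Allₚ.map⁺ (All.universal (λ _ → ℕP.≤-refl) (range (suc a) (k ∸ a))))
           (All.map (ℕP.≤-trans (ℕP.n≤1+n s)) (All-skewCells-row≥ (suc s) κ ν gs))

zip-shiftedCells-∷ : ∀ {B : Set} {r} i a (μ : Vec ℕ r) g gs (w : List B) →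
  zip (shiftedCellsFrom i (a ∷ μ) (g ∷ gs)) w ≡
  zip (rowCells i i a g) w ++ zip (shiftedCellsFrom (suc i) μ gs) (drop a w)
zip-shiftedCells-∷ i a μ g gs w
  rewrite zip-++ˡ (rowCells i i a g) (shiftedCellsFrom (suc i) μ gs) w | length-rowCells i i a g = refl

zip-skewCells-∷ : ∀ {B : Set} {r} t l (la : Vec ℕ r) a μ g gs (w : List B) →
  zip (skewCellsFrom (suc t) (barFrom t (l ∷ la)) (barFrom t (a ∷ μ)) (g ∷ gs)) w ≡
  zip (rowCells (suc t) (suc t + a) (l ∸ a) g) w ++
  zip (skewCellsFrom (suc (suc t)) (barFrom (suc t) la) (barFrom (suc t) μ) gs) (drop (l ∸ a) w)
zip-skewCells-∷ t l la a μ g gs w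
  rewrite ℕP.+-comm l t | ℕP.+-comm a t | ℕP.[m+n]∸[m+o]≡n∸o t l a
        | zip-++ˡ (rowCells (suc t) (suc t + a) (l ∸ a) g)
                  (skewCellsFrom (suc (suc t)) (barFrom (suc t) la) (barFrom (suc t) μ) gs) w
        | length-rowCells (suc t) (suc t + a) (l ∸ a) g = refl

length-shiftedCells : ∀ {r} s (la f : Vec ℕ r) → length (shiftedCellsFrom s la f) ≡ Vec.sum la
length-shiftedCells s [] [] = refl
length-shiftedCells s (l ∷ la) (g ∷ f) =
  trans (length-++ (rowCells s s l g)) (cong₂ _+_ (length-rowCells s s l g) (length-shiftedCells (suc s) la f))

plainEntry : ℕ ⊎ ℕ → Entry
plainEntry (inj₁ k) = unm k
plainEntry (inj₂ k) = pr k

entry : (ℕ ⊎ ℕ) ⊎ ℕ → Entry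
entry (inj₁ y) = plainEntry y
entry (inj₂ k) = circ k

_≼_ : Cell → Cell → Set
c′ ≼ c = (row c ≡ row c′ → col c′ ≤ col c) × (col c ≡ col c′ → row c′ ≤ row c)

mstPairOK-circ-plain : ∀ c c′ e y → c′ ≼ c → mstPairOK (c , circ e) (c′ , plainEntry y) ≡ true
mstPairOK-circ-plain c c′ e y (sameRow , sameCol) = circ-before y
  where
  notSameRowBefore : ((row c ≡ᵇ row c′) ∧ (col c <ᵇ col c′)) ≡ false
  notSameRowBefore = ∧≡false (λ eq → ≥⇒<ᵇ≡false (sameRow (≡ᵇ≡true⇒≡ eq)))
  notSameColBefore : ((col c ≡ᵇ col c′) ∧ (row c <ᵇ row c′)) ≡ false
  notSameColBefore = ∧≡false (λ eq → ≥⇒<ᵇ≡false (sameCol (≡ᵇ≡true⇒≡ eq)))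
  circ-before : ∀ y → mstPairOK (c , circ e) (c′ , plainEntry y) ≡ true
  circ-before (inj₁ _) rewrite notSameRowBefore | notSameColBefore = refl
  circ-before (inj₂ _) rewrite notSameRowBefore | notSameColBefore = refl

mstPairOK-circ-above-plain : ∀ i j g i′ g′ e y → i < i′ →
                             mstPairOK ((i , j , g) , circ e) ((i′ , j , g′) , plainEntry y) ≡ false
mstPairOK-circ-above-plain i j g i′ g′ e (inj₁ _) i<i′
  rewrite ≢⇒≡ᵇ≡false (λ eq → ℕP.<-irrefl eq i<i′) | ≡ᵇ-refl j | <⇒<ᵇ≡true i<i′ = refl
mstPairOK-circ-above-plain i j g i′ g′ e (inj₂ _) i<i′
  rewrite ≢⇒≡ᵇ≡false (λ eq → ℕP.<-irrefl eq i<i′) | ≡ᵇ-refl j | <⇒<ᵇ≡true i<i′ = refl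

mstPairOK-circ-left-of-plain : ∀ i j g j′ g′ e y → j < j′ →
                               mstPairOK ((i , j , g) , circ e) ((i , j′ , g′) , plainEntry y) ≡ false
mstPairOK-circ-left-of-plain i j g j′ g′ e (inj₁ _) j<j′ rewrite ≡ᵇ-refl i | <⇒<ᵇ≡true j<j′ = refl
mstPairOK-circ-left-of-plain i j g j′ g′ e (inj₂ _) j<j′ rewrite ≡ᵇ-refl i | <⇒<ᵇ≡true j<j′ = refl

mstPairOK-plain-circ : ∀ c c′ y e → mstPairOK (c , plainEntry y) (c′ , circ e) ≡ true
mstPairOK-plain-circ c c′ (inj₁ _) e
  rewrite ∨-zeroʳ (not ((row c ≡ᵇ row c′) ∧ (col c <ᵇ col c′)))
        | ∨-zeroʳ (not ((col c ≡ᵇ col c′) ∧ (row c <ᵇ row c′))) = refl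
mstPairOK-plain-circ c c′ (inj₂ _) e
  rewrite ∨-zeroʳ (not ((row c ≡ᵇ row c′) ∧ (col c <ᵇ col c′)))
        | ∨-zeroʳ (not ((col c ≡ᵇ col c′) ∧ (row c <ᵇ row c′))) = refl

mstPairOK-circ-circ : ∀ c c′ e e′ → mstPairOK (c , circ e) (c′ , circ e′) ≡ sstPairOK (c , e) (c′ , e′)
mstPairOK-circ-circ c c′ e e′ rewrite ≤ᵇ∧≢ᵇ≡<ᵇ e e′ | ∧-identityʳ (e ≤ᵇ e′) = refl

mstRowOK-plain : ∀ c y → mstRowOK (c , plainEntry y) ≡ true
mstRowOK-plain c (inj₁ _) = refl
mstRowOK-plain c (inj₂ _) = refl

pairsOK : Filling → Filling → Bool
pairsOK A B = all (λ p → all (mstPairOK p) B) A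

pairsOK-++ : ∀ A₁ A₂ B₁ B₂ → pairsOK (A₁ ++ A₂) (B₁ ++ B₂) ≡
             ((pairsOK A₁ B₁ ∧ pairsOK A₁ B₂) ∧ (pairsOK A₂ B₁ ∧ pairsOK A₂ B₂))
pairsOK-++ A₁ A₂ B₁ B₂ =
  trans (all-++ _ A₁ A₂)
        (cong₂ _∧_ (split A₁) (split A₂))
  where
  split : ∀ A → pairsOK A (B₁ ++ B₂) ≡ (pairsOK A B₁ ∧ pairsOK A B₂)
  split A = trans (all-cong′ A (λ p → all-++ (mstPairOK p) B₁ B₂)) (all-∧ _ _ A)

All⇒pairsOK : ∀ {P Q : Cell × Entry → Set} {A B} → All P A → All Q B →
              (∀ {p q} → P p → Q q → mstPairOK p q ≡ true) → pairsOK A B ≡ true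
All⇒pairsOK pa qb h = All⇒all≡true pa (λ p → All⇒all≡true qb (h p))

∈⇒pairsOK≡false : ∀ {p q} A B → p ∈ A → q ∈ B → mstPairOK p q ≡ false → pairsOK A B ≡ false
∈⇒pairsOK≡false A B p∈A q∈B e = ∈⇒all≡false A p∈A (∈⇒all≡false B q∈B e)

∈⇒isMST≡false : ∀ {p q} T → p ∈ T → q ∈ T → mstPairOK p q ≡ false → isMST T ≡ false
∈⇒isMST≡false T p∈T q∈T e =
  trans (cong (all mstRowOK T ∧_) (∈⇒pairsOK≡false T T p∈T q∈T e)) (∧-zeroʳ (all mstRowOK T))

isMST-interleaving : ∀ {M S T} → Interleaving M S T → isMST T ≡
  ((all mstRowOK M ∧ all mstRowOK S) ∧ ((pairsOK M M ∧ pairsOK S M) ∧ (pairsOK M S ∧ pairsOK S S)))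
isMST-interleaving {M} {S} {T} i =
  cong₂ _∧_ (all-interleaving mstRowOK i)
    (trans (all-cong′ T (λ p → all-interleaving (mstPairOK p) i))
      (trans (all-∧ (λ p → all (mstPairOK p) M) (λ p → all (mstPairOK p) S) T)
        (cong₂ _∧_ (all-interleaving (λ p → all (mstPairOK p) M) i)
                   (all-interleaving (λ p → all (mstPairOK p) S) i))))

all-mstRowOK-plain : ∀ (cs : List Cell) U → all mstRowOK (zip cs (map plainEntry U)) ≡ true
all-mstRowOK-plain cs U =
  All⇒all≡true (All-zip⁺ʳ cs (All-map-image plainEntry U))
               (λ { {c , _} (y , refl) → mstRowOK-plain c y })

pairsOK-plain-circ : ∀ (cs cs′ : List Cell) U V → pairsOK (zip cs (map plainEntry U)) (zip cs′ (map circ V)) ≡ true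
pairsOK-plain-circ cs cs′ U V =
  All⇒pairsOK (All-zip⁺ʳ cs (All-map-image plainEntry U)) (All-zip⁺ʳ cs′ (All-map-image circ V))
              (λ { {c , _} {c′ , _} (y , refl) (e , refl) → mstPairOK-plain-circ c c′ y e })

position : Cell → ℕ × ℕ
position c = row c , col c

positions-rowCells : ∀ i s m g g′ → map position (rowCells i s m g) ≡ map position (rowCells i s m g′)
positions-rowCells i s m g g′ = trans (sym (map-∘ (range s m))) (map-∘ (range s m))

positions-shiftedCells : ∀ {r} s (μ g g′ : Vec ℕ r) →
                         map position (shiftedCellsFrom s μ g) ≡ map position (shiftedCellsFrom s μ g′)
positions-shiftedCells s [] [] [] = refl
positions-shiftedCells s (a ∷ μ) (g ∷ gs) (g′ ∷ gs′) =
  trans (map-++ position (rowCells s s a g) _)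
    (trans (cong₂ _++_ (positions-rowCells s s a g g′) (positions-shiftedCells (suc s) μ gs gs′))
           (sym (map-++ position (rowCells s s a g′) _)))

forgetFlag : Cell × Entry → (ℕ × ℕ) × Entry
forgetFlag (c , e) = position c , e

-- mstPairOK never inspects the flag component of a cell.
pairOKᵖ : (ℕ × ℕ) × Entry → (ℕ × ℕ) × Entry → Bool
pairOKᵖ ((i , j) , e) ((i′ , j′) , e′) = mstPairOK ((i , j , 0) , e) ((i′ , j′ , 0) , e′)

pairsOK-forgetFlag : ∀ A B → pairsOK A B ≡ all (λ p → all (pairOKᵖ p) (map forgetFlag B)) (map forgetFlag A)
pairsOK-forgetFlag A B =
  trans (all-cong′ A (λ p → sym (all-map (pairOKᵖ (forgetFlag p)) forgetFlag B)))
        (sym (all-map _ forgetFlag A))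

forgetFlag-zip : ∀ (cs : List Cell) W → map forgetFlag (zip cs W) ≡ zip (map position cs) W
forgetFlag-zip [] W = refl
forgetFlag-zip (c ∷ cs) [] = refl
forgetFlag-zip (c ∷ cs) (e ∷ W) = cong (_ ∷_) (forgetFlag-zip cs W)

pairsOK-positions : ∀ (cs cs′ : List Cell) W → map position cs ≡ map position cs′ →
                    pairsOK (zip cs W) (zip cs W) ≡ pairsOK (zip cs′ W) (zip cs′ W)
pairsOK-positions cs cs′ W e
  rewrite pairsOK-forgetFlag (zip cs W) (zip cs W) | pairsOK-forgetFlag (zip cs′ W) (zip cs′ W)
        | forgetFlag-zip cs W | forgetFlag-zip cs′ W | e = refl

mstRowOK-circ : ∀ c {e} → 1 ≤ e → mstRowOK (c , circ e) ≡ sstRowOK (c , e)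
mstRowOK-circ c (s≤s _) = refl

isMST-circ : ∀ (S : SFilling) → All ((1 ≤_) ∘ proj₂) S → isMST (map (map₂ circ) S) ≡ isSST S
isMST-circ S positive = cong₂ _∧_
  (trans (all-map mstRowOK _ S) (all-cong positive (λ {p} → mstRowOK-circ (proj₁ p))))
  (trans (all-map _ _ S)
    (all-cong′ S (λ p → trans (all-map (mstPairOK (circled p)) circled S)
                               (all-cong′ S (λ q → mstPairOK-circ-circ (proj₁ p) (proj₁ q) (proj₂ p) (proj₂ q))))))
  where
  circled = map₂ circ

rowwiseMerge : ∀ {X Y : Set} {r} → Vec ℕ r → Vec ℕ r → List X → List Y → List (X ⊎ Y)
rowwiseMerge [] [] U V = []
rowwiseMerge (l ∷ la) (a ∷ μ) U V =
  (map inj₁ (take a U) ++ map inj₂ (take (l ∸ a) V)) ++ rowwiseMerge la μ (drop a U) (drop (l ∸ a) V)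

skewSize : ∀ {r} → Vec ℕ r → Vec ℕ r → ℕ
skewSize [] [] = 0
skewSize (l ∷ la) (a ∷ μ) = (l ∸ a) + skewSize la μ

length-skewCells : ∀ {r} t (la μ f : Vec ℕ r) →
                   length (skewCellsFrom (suc t) (barFrom t la) (barFrom t μ) f) ≡ skewSize la μ
length-skewCells t [] [] [] = refl
length-skewCells t (l ∷ la) (a ∷ μ) (g ∷ f)
  rewrite ℕP.+-comm l t | ℕP.+-comm a t | ℕP.[m+n]∸[m+o]≡n∸o t l a =
  trans (length-++ (rowCells (suc t) (suc t + a) (l ∸ a) g))
        (cong₂ _+_ (length-rowCells (suc t) (suc t + a) (l ∸ a) g) (length-skewCells (suc t) la μ f))

plainFilling : ∀ {r} → ℕ → Vec ℕ r → Vec ℕ r → List (ℕ ⊎ ℕ) → Filling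
plainFilling t μ f U = zip (shiftedCellsFrom (suc t) μ f) (map plainEntry U)

skewFilling : ∀ {r} → ℕ → Vec ℕ r → Vec ℕ r → Vec ℕ r → List ℕ → SFilling
skewFilling t la μ f V = zip (skewCellsFrom (suc t) (barFrom t la) (barFrom t μ) f) V

circledFilling : ∀ {r} → ℕ → Vec ℕ r → Vec ℕ r → Vec ℕ r → List ℕ → Filling
circledFilling t la μ f V = zip (skewCellsFrom (suc t) (barFrom t la) (barFrom t μ) f) (map circ V)

crossOK : ∀ {r} → ℕ → Vec ℕ r → Vec ℕ r → Vec ℕ r → List (ℕ ⊎ ℕ) → List ℕ → Bool
crossOK t la μ f U V = pairsOK (circledFilling t la μ f V) (plainFilling t μ f U)

mergedFilling : ∀ {r} → ℕ → Vec ℕ r → Vec ℕ r → Vec ℕ r → List (ℕ ⊎ ℕ) → List ℕ → Filling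
mergedFilling t la μ f U V = zip (shiftedCellsFrom (suc t) la f) (map entry (rowwiseMerge la μ U V))

plainFilling-∷ : ∀ {r} t a (μ : Vec ℕ r) g f U →
  plainFilling t (a ∷ μ) (g ∷ f) U ≡
  zip (rowCells (suc t) (suc t) a g) (map plainEntry U) ++ plainFilling (suc t) μ f (drop a U)
plainFilling-∷ t a μ g f U rewrite zip-shiftedCells-∷ (suc t) a μ g f (map plainEntry U) | drop-map {f = plainEntry} a U = refl

circledFilling-∷ : ∀ {r} t l (la : Vec ℕ r) a μ g f V →
  circledFilling t (l ∷ la) (a ∷ μ) (g ∷ f) V ≡
  zip (rowCells (suc t) (suc t + a) (l ∸ a) g) (map circ V) ++ circledFilling (suc t) la μ f (drop (l ∸ a) V)
circledFilling-∷ t l la a μ g f V rewrite zip-skewCells-∷ t l la a μ g f (map circ V) | drop-map {f = circ} (l ∸ a) V = refl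

mergedFilling-∷ : ∀ {r} t l (la : Vec ℕ r) a μ g f U V → a ≤ l → a ≤ length U → l ∸ a ≤ length V →
  mergedFilling t (l ∷ la) (a ∷ μ) (g ∷ f) U V ≡
  (zip (rowCells (suc t) (suc t) a g) (map plainEntry U) ++ zip (rowCells (suc t) (suc t + a) (l ∸ a) g) (map circ V)) ++
  mergedFilling (suc t) la μ f (drop a U) (drop (l ∸ a) V)
mergedFilling-∷ t l la a μ g f U V a≤l a≤U l∸a≤V = begin
  zip (rowCells i i l g ++ rest) (map entry (firstRow ++ laterRows))
    ≡⟨ cong (zip (rowCells i i l g ++ rest)) (map-++ entry firstRow laterRows) ⟩
  zip (rowCells i i l g ++ rest) (map entry firstRow ++ map entry laterRows)
    ≡⟨ zip-++ (rowCells i i l g) rest (map entry firstRow) (map entry laterRows) length-firstRow ⟩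
  zip (rowCells i i l g) (map entry firstRow) ++ zip rest (map entry laterRows)
    ≡⟨ cong (_++ zip rest (map entry laterRows)) firstRow-split ⟩
  (zip (rowCells i i a g) (map plainEntry U) ++ zip (rowCells i (i + a) (l ∸ a) g) (map circ V)) ++
  zip rest (map entry laterRows) ∎
  where
  open ≡-Reasoning
  i = suc t
  rest = shiftedCellsFrom (suc i) la f
  firstRow = map inj₁ (take a U) ++ map inj₂ (take (l ∸ a) V)
  laterRows = rowwiseMerge la μ (drop a U) (drop (l ∸ a) V)
  length-take-map : ∀ {A B : Set} (h : A → B) k (w : List A) → k ≤ length w → length (map h (take k w)) ≡ k
  length-take-map h k w k≤ = trans (length-map h (take k w)) (length-take-≤ k w k≤)
  entries-firstRow : map entry firstRow ≡ map plainEntry (take a U) ++ map circ (take (l ∸ a) V)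
  entries-firstRow = trans (map-++ entry (map inj₁ (take a U)) _)
    (cong₂ _++_ (sym (map-∘ (take a U))) (sym (map-∘ (take (l ∸ a) V))))
  length-firstRow : length (rowCells i i l g) ≡ length (map entry firstRow)
  length-firstRow = trans (length-rowCells i i l g) (sym (trans (cong length entries-firstRow)
    (trans (length-++ (map plainEntry (take a U)))
      (trans (cong₂ _+_ (length-take-map plainEntry a U a≤U) (length-take-map circ (l ∸ a) V l∸a≤V))
             (ℕP.m+[n∸m]≡n a≤l)))))
  zip-rowCells-take : ∀ {B : Set} (h : B → Entry) k (w : List B) s →
    zip (rowCells i s k g) (map h (take k w)) ≡ zip (rowCells i s k g) (map h w)
  zip-rowCells-take h k w s =
    trans (cong (zip (rowCells i s k g)) (sym (take-map k w))) (zip-take (rowCells i s k g) (map h w) (length-rowCells i s k g))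
  firstRow-split : zip (rowCells i i l g) (map entry firstRow) ≡
                   zip (rowCells i i a g) (map plainEntry U) ++ zip (rowCells i (i + a) (l ∸ a) g) (map circ V)
  firstRow-split = trans (cong₂ zip (rowCells-++ i i a l g a≤l) entries-firstRow)
    (trans (zip-++ (rowCells i i a g) _ (map plainEntry (take a U)) _
             (trans (length-rowCells i i a g) (sym (length-take-map plainEntry a U a≤U))))
      (cong₂ _++_ (zip-rowCells-take plainEntry a U i) (zip-rowCells-take circ (l ∸ a) V (i + a))))

mergedFilling-interleaving : ∀ {r} t (la μ f : Vec ℕ r) U V → Pointwise _≤_ μ la →
  length U ≡ Vec.sum μ → length V ≡ skewSize la μ →
  Interleaving (plainFilling t μ f U) (circledFilling t la μ f V) (mergedFilling t la μ f U V)
mergedFilling-interleaving t [] [] [] U V _ _ _ = []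
mergedFilling-interleaving t (l ∷ la) (a ∷ μ) (g ∷ f) U V (a≤l ∷ μ≤la) |U| |V|
  with length≡+⇒drop a (Vec.sum μ) U |U| | length≡+⇒drop (l ∸ a) (skewSize la μ) V |V|
... | a≤U , |U′| | l∸a≤V , |V′|
  rewrite mergedFilling-∷ t l la a μ g f U V a≤l a≤U l∸a≤V
        | plainFilling-∷ t a μ g f U | circledFilling-∷ t l la a μ g f V =
  Interₚ.++⁺ (Interₚ.++-disjoint (Inter.left (ListPointwise.refl refl)) (Inter.right (ListPointwise.refl refl)))
             (mergedFilling-interleaving (suc t) la μ f (drop a U) (drop (l ∸ a) V) μ≤la |U′| |V′|)

-- Strict μ: the circled part never precedes the plain part

paddedStrict-tail : ∀ {r} a (μ : Vec ℕ r) → paddedStrictᵇ (a ∷ toList μ) ≡ true → paddedStrictᵇ (toList μ) ≡ true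
paddedStrict-tail a [] _ = refl
paddedStrict-tail a (b ∷ μ) h = proj₂ (∧≡true⇒ h)

paddedStrict-0∷⇒zeros : ∀ {r} (μ : Vec ℕ r) → paddedStrictᵇ (0 ∷ toList μ) ≡ true → VecAll.All (_≡ 0) μ
paddedStrict-0∷⇒zeros [] _ = []
paddedStrict-0∷⇒zeros (zero ∷ μ) h = refl ∷ paddedStrict-0∷⇒zeros μ (proj₂ (∧≡true⇒ h))

shiftedCells-zeros : ∀ {r} s {μ : Vec ℕ r} (g : Vec ℕ r) → VecAll.All (_≡ 0) μ → shiftedCellsFrom s μ g ≡ []
shiftedCells-zeros s [] [] = refl
shiftedCells-zeros s (g ∷ gs) (refl ∷ zeros) = shiftedCells-zeros (suc s) gs zeros

∨-∧false≡true⇒ : ∀ {x y} → (x ∨ (y ∧ false)) ≡ true → x ≡ true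
∨-∧false≡true⇒ {true} _ = refl
∨-∧false≡true⇒ {false} {true} ()
∨-∧false≡true⇒ {false} {false} ()

All-shiftedCells-col< : ∀ {r} t a (μ g : Vec ℕ r) → paddedStrictᵇ (a ∷ toList μ) ≡ true →
                        All (λ c → col c < suc t + a) (shiftedCellsFrom (suc (suc t)) μ g)
All-shiftedCells-col< t a [] [] _ = []
All-shiftedCells-col< t a (zero ∷ μ) (g ∷ gs) h
  rewrite shiftedCells-zeros (suc (suc (suc t))) gs (paddedStrict-0∷⇒zeros μ (proj₂ (∧≡true⇒ h))) = []
All-shiftedCells-col< t a (suc b ∷ μ) (g ∷ gs) h =
  Allₚ.++⁺ (All.map (λ (_ , _ , j<) → ℕP.<-≤-trans j< rowEnd≤) (All-rowCells (suc (suc t)) (suc (suc t)) (suc b) g))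
           (All.map (λ j< → ℕP.<-≤-trans j< rowEnd≤) (All-shiftedCells-col< (suc t) (suc b) μ gs (proj₂ (∧≡true⇒ h))))
  where
  b<a : suc b < a
  b<a = <ᵇ≡true⇒< (∨-∧false≡true⇒ (proj₁ (∧≡true⇒ h)))
  rowEnd≤ : suc (suc t) + suc b ≤ suc t + a
  rowEnd≤ = subst (_≤ suc t + a) (cong suc (ℕP.+-suc t (suc b))) (ℕP.+-monoʳ-≤ (suc t) b<a)

pairsOK-circ-plain : ∀ {P Q : Cell → Set} {cs cs′ : List Cell} V U → All P cs → All Q cs′ →
  (∀ {c c′} → P c → Q c′ → c′ ≼ c) → pairsOK (zip cs (map circ V)) (zip cs′ (map plainEntry U)) ≡ true
pairsOK-circ-plain {cs = cs} {cs′} V U Pcs Qcs′ ≼-PQ =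
  All⇒pairsOK (All-zip⁺ Pcs (All-map-image circ V)) (All-zip⁺ Qcs′ (All-map-image plainEntry U))
    (λ { {c , _} {c′ , _} (Pc , e , refl) (Qc′ , y , refl) → mstPairOK-circ-plain c c′ e y (≼-PQ Pc Qc′) })

crossOK-strict : ∀ {r} t (la μ f : Vec ℕ r) U V → paddedStrictᵇ (toList μ) ≡ true →
                        crossOK t la μ f U V ≡ true
crossOK-strict t [] [] [] U V _ = refl
crossOK-strict t (l ∷ la) (a ∷ μ) (g ∷ f) U V strict =
  trans (cong₂ pairsOK (circledFilling-∷ t l la a μ g f V) (plainFilling-∷ t a μ g f U))
    (trans (pairsOK-++ circledRow circledBelow plainRow plainBelow)
      (cong₂ _∧_ (cong₂ _∧_ rowVsRow rowVsBelow)
                 (cong₂ _∧_ belowVsRow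
                            (crossOK-strict (suc t) la μ f (drop a U) (drop (l ∸ a) V) (paddedStrict-tail a μ strict)))))
  where
  i = suc t
  circledRow = zip (rowCells i (i + a) (l ∸ a) g) (map circ V)
  circledBelow = circledFilling (suc t) la μ f (drop (l ∸ a) V)
  plainRow = zip (rowCells i i a g) (map plainEntry U)
  plainBelow = plainFilling (suc t) μ f (drop a U)
  rowVsRow : pairsOK circledRow plainRow ≡ true
  rowVsRow = pairsOK-circ-plain V U (All-rowCells i (i + a) (l ∸ a) g) (All-rowCells i i a g)
    (λ { (refl , a≤j , _) (i≡ , _ , j′<) → (λ _ → ℕP.<⇒≤ (ℕP.<-≤-trans j′< a≤j)) , (λ _ → ℕP.≤-reflexive i≡) })
  rowVsBelow : pairsOK circledRow plainBelow ≡ true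
  rowVsBelow = pairsOK-circ-plain V (drop a U) (All-rowCells i (i + a) (l ∸ a) g)
    (All.zip (All-shiftedCells-row≥ (suc i) μ f , All-shiftedCells-col< t a μ f strict))
    (λ { (i≡ , a≤j , _) (i<i′ , j′<) →
           (λ e → ⊥-elim (ℕP.<-irrefl (trans (sym i≡) e) i<i′)) ,
           (λ e → ⊥-elim (ℕP.<-irrefl (sym e) (ℕP.<-≤-trans j′< a≤j))) })
  belowVsRow : pairsOK circledBelow plainRow ≡ true
  belowVsRow = pairsOK-circ-plain (drop (l ∸ a) V) U
    (All-skewCells-row≥ (suc i) (barFrom (suc t) la) (barFrom (suc t) μ) f) (All-rowCells i i a g)
    (λ { i<i′ (i≡ , _ , _) →
           (λ e → ⊥-elim (ℕP.<-irrefl (trans (sym i≡) (sym e)) i<i′)) ,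
           (λ _ → subst (_≤ _) (sym i≡) (ℕP.<⇒≤ i<i′)) })

-- Non-strict μ: some circled entry sits directly above a plain one

∈-zip-rowCells : ∀ {B : Set} i s m g (h : B → Entry) (w : List B) k → k < m → k < length w →
                 ∃ λ y → ((i , s + k , g) , h y) ∈ zip (rowCells i s m g) (map h w)
∈-zip-rowCells i s (suc m) g h (y ∷ w) zero _ _ =
  y , here (cong (λ j → ((i , j , g) , h y)) (ℕP.+-identityʳ s))
∈-zip-rowCells i s (suc m) g h (y ∷ w) (suc k) (s≤s k<m) (s≤s k<w)
  with ∈-zip-rowCells i (suc s) m g h w k k<m k<w
... | y′ , y′∈ = y′ , there (subst (λ j → ((i , j , g) , h y′) ∈ zip (rowCells i (suc s) m g) (map h w))
                                  (sym (ℕP.+-suc s k)) y′∈)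

pairsOK-circled-above-plain : ∀ {r} t l a b (μ : Vec ℕ r) g g₂ f U V → a ≤ suc b → suc b < l →
  l ∸ a ≤ length V → suc b ≤ length U →
  pairsOK (zip (rowCells (suc t) (suc t + a) (l ∸ a) g) (map circ V)) (plainFilling (suc t) (suc b ∷ μ) (g₂ ∷ f) U) ≡ false
pairsOK-circled-above-plain t l a b μ g g₂ f U V a≤b+1 b+1<l l∸a≤V b+1≤U =
  ∈⇒pairsOK≡false _ _ circled∈ plain∈
    (mstPairOK-circ-above-plain (suc t) column g (suc (suc t)) g₂ (proj₁ circledCell) (proj₁ plainCell) (ℕP.n<1+n (suc t)))
  where
  column = suc t + suc b
  offset< : suc b ∸ a < l ∸ a
  offset< = ℕP.∸-monoˡ-< b+1<l a≤b+1
  circledCell = ∈-zip-rowCells (suc t) (suc t + a) (l ∸ a) g circ V (suc b ∸ a) offset< (ℕP.<-≤-trans offset< l∸a≤V)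
  plainCell = ∈-zip-rowCells (suc (suc t)) (suc (suc t)) (suc b) g₂ plainEntry U b (ℕP.n<1+n b) b+1≤U
  circled∈ : ((suc t , column , g) , circ (proj₁ circledCell)) ∈ zip (rowCells (suc t) (suc t + a) (l ∸ a) g) (map circ V)
  circled∈ = subst (λ j → ((suc t , j , g) , circ (proj₁ circledCell)) ∈ zip (rowCells (suc t) (suc t + a) (l ∸ a) g) (map circ V))
                   (trans (ℕP.+-assoc (suc t) a _) (cong (suc t +_) (ℕP.m+[n∸m]≡n a≤b+1))) (proj₂ circledCell)
  plain∈ : ((suc (suc t) , column , g₂) , plainEntry (proj₁ plainCell)) ∈ plainFilling (suc t) (suc b ∷ μ) (g₂ ∷ f) U
  plain∈ = subst (((suc (suc t) , column , g₂) , plainEntry (proj₁ plainCell)) ∈_) (sym (plainFilling-∷ (suc t) (suc b) μ g₂ f U))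
             (∈-++⁺ˡ (subst (λ j → ((suc (suc t) , j , g₂) , plainEntry (proj₁ plainCell))
                                      ∈ zip (rowCells (suc (suc t)) (suc (suc t)) (suc b) g₂) (map plainEntry U))
                            (sym (ℕP.+-suc (suc t) b)) (proj₂ plainCell)))

paddedStrict-head-zero : ∀ a → ((0 <ᵇ a) ∨ ((a ≡ᵇ 0) ∧ (0 ≡ᵇ 0))) ≡ false → ⊥
paddedStrict-head-zero zero ()
paddedStrict-head-zero (suc a) ()

crossOK-nonstrict-step : ∀ {r} t l l₂ (la : Vec ℕ r) a b μ g g₂ f U V → l₂ < l → b ≤ l₂ →
  length U ≡ a + (b + Vec.sum μ) → length V ≡ skewSize (l ∷ l₂ ∷ la) (a ∷ b ∷ μ) →
  paddedStrictᵇ (toList (a ∷ b ∷ μ)) ≡ false →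
  (paddedStrictᵇ (toList (b ∷ μ)) ≡ false →
     crossOK (suc t) (l₂ ∷ la) (b ∷ μ) (g₂ ∷ f) (drop a U) (drop (l ∸ a) V) ≡ false) →
  crossOK t (l ∷ l₂ ∷ la) (a ∷ b ∷ μ) (g ∷ g₂ ∷ f) U V ≡ false
crossOK-nonstrict-step t l l₂ la a b μ g g₂ f U V l₂<l b≤l₂ |U| |V| nonstrict laterRows =
  trans (cong₂ pairsOK (circledFilling-∷ t l (l₂ ∷ la) a (b ∷ μ) g (g₂ ∷ f) V) (plainFilling-∷ t a (b ∷ μ) g (g₂ ∷ f) U))
    (trans (pairsOK-++ circledRow circledBelow plainRow plainBelow) (clash _ refl))
  where
  circledRow = zip (rowCells (suc t) (suc t + a) (l ∸ a) g) (map circ V)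
  circledBelow = circledFilling (suc t) (l₂ ∷ la) (b ∷ μ) (g₂ ∷ f) (drop (l ∸ a) V)
  plainRow = zip (rowCells (suc t) (suc t) a g) (map plainEntry U)
  plainBelow = plainFilling (suc t) (b ∷ μ) (g₂ ∷ f) (drop a U)
  |U′| = proj₂ (length≡+⇒drop a (b + Vec.sum μ) U |U|)
  l∸a≤V = proj₁ (length≡+⇒drop (l ∸ a) (skewSize (l₂ ∷ la) (b ∷ μ)) V |V|)
  rowAboveClash : ∀ b → b ≤ l₂ → ((b <ᵇ a) ∨ ((a ≡ᵇ 0) ∧ (b ≡ᵇ 0))) ≡ false →
                  length (drop a U) ≡ b + Vec.sum μ → pairsOK circledRow (plainFilling (suc t) (b ∷ μ) (g₂ ∷ f) (drop a U)) ≡ false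
  rowAboveClash zero _ headBad _ = ⊥-elim (paddedStrict-head-zero a headBad)
  rowAboveClash (suc b) b≤l₂ headBad |U′| =
    pairsOK-circled-above-plain t l a b μ g g₂ f (drop a U) V (<ᵇ≡false⇒≥ (proj₁ (∨≡false⇒ headBad)))
      (ℕP.≤-<-trans b≤l₂ l₂<l) l∸a≤V (subst (suc b ≤_) (sym |U′|) (ℕP.m≤m+n (suc b) (Vec.sum μ)))
  clash : ∀ headOK → ((b <ᵇ a) ∨ ((a ≡ᵇ 0) ∧ (b ≡ᵇ 0))) ≡ headOK →
          ((pairsOK circledRow plainRow ∧ pairsOK circledRow plainBelow) ∧
           (pairsOK circledBelow plainRow ∧ pairsOK circledBelow plainBelow)) ≡ false
  clash true eq = ∧-∧-false₄ (pairsOK circledRow plainRow) (pairsOK circledRow plainBelow) (pairsOK circledBelow plainRow)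
                   (laterRows (subst (λ x → (x ∧ paddedStrictᵇ (toList (b ∷ μ))) ≡ false) eq nonstrict))
  clash false eq = ∧-∧-false₂ (pairsOK circledRow plainRow) (pairsOK circledBelow plainRow) (pairsOK circledBelow plainBelow)
                     (rowAboveClash b b≤l₂ eq |U′|)

crossOK-nonstrict : ∀ {r} t (la μ f : Vec ℕ r) U V → StrictPartition (toList la) → Pointwise _≤_ μ la →
  length U ≡ Vec.sum μ → length V ≡ skewSize la μ → paddedStrictᵇ (toList μ) ≡ false →
  crossOK t la μ f U V ≡ false
crossOK-nonstrict t (l ∷ l₂ ∷ la) (a ∷ b ∷ μ) (g ∷ g₂ ∷ f) U V (l₂<l , strict) (a≤l ∷ b≤l₂ ∷ μ≤la) |U| |V| nonstrict =
  crossOK-nonstrict-step t l l₂ la a b μ g g₂ f U V l₂<l b≤l₂ |U| |V| nonstrict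
    (crossOK-nonstrict (suc t) (l₂ ∷ la) (b ∷ μ) (g₂ ∷ f) (drop a U) (drop (l ∸ a) V) strict (b≤l₂ ∷ μ≤la)
       (proj₂ (length≡+⇒drop a (Vec.sum (b ∷ μ)) U |U|))
       (proj₂ (length≡+⇒drop (l ∸ a) (skewSize (l₂ ∷ la) (b ∷ μ)) V |V|)))

-- Strict μ with μ̄ not a partition: some row of λ̄/μ̄ is longer than its flag allows

record OverfullRow (T : SFilling) : Set where
  constructor overfullRow
  field
    i s m g : ℕ
    W : List ℕ
    g<m : g < m
    m≤W : m ≤ length W
    rowFilling⊆ : ∀ {p} → p ∈ zip (rowCells i s m g) W → p ∈ T

OverfullRow-mono : ∀ {T T′} → (∀ {p} → p ∈ T → p ∈ T′) → OverfullRow T → OverfullRow T′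
OverfullRow-mono T⊆T′ (overfullRow i s m g W g<m m≤W ⊆T) = overfullRow i s m g W g<m m≤W (T⊆T′ ∘ ⊆T)

∈-skewFilling-row : ∀ {r} t l (la : Vec ℕ r) a μ g f V {p} →
  p ∈ zip (rowCells (suc t) (suc t + a) (l ∸ a) g) V → p ∈ skewFilling t (l ∷ la) (a ∷ μ) (g ∷ f) V
∈-skewFilling-row t l la a μ g f V p∈ = subst (_ ∈_) (sym (zip-skewCells-∷ t l la a μ g f V)) (∈-++⁺ˡ p∈)

∈-skewFilling-below : ∀ {r} t l (la : Vec ℕ r) a μ g f V {p} →
  p ∈ skewFilling (suc t) la μ f (drop (l ∸ a) V) → p ∈ skewFilling t (l ∷ la) (a ∷ μ) (g ∷ f) V
∈-skewFilling-below t l la a μ g f V p∈ =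
  subst (_ ∈_) (sym (zip-skewCells-∷ t l la a μ g f V)) (∈-++⁺ʳ (zip (rowCells (suc t) (suc t + a) (l ∸ a) g) V) p∈)

overfullRow-trailingZeros : ∀ {r} t l₁ l₂ (la : Vec ℕ r) μ g₁ g₂ f V → VecAll.All (_≡ 0) μ → LastTwo (l₁ ∷ l₂ ∷ la) (g₁ ∷ g₂ ∷ f) →
  length V ≡ skewSize (l₁ ∷ l₂ ∷ la) (0 ∷ 0 ∷ μ) → OverfullRow (skewFilling t (l₁ ∷ l₂ ∷ la) (0 ∷ 0 ∷ μ) (g₁ ∷ g₂ ∷ f) V)
overfullRow-trailingZeros t l₁ l₂ [] [] g₁ g₂ [] V [] (inj₁ g₁<l₁) |V| =
  overfullRow (suc t) (suc t + 0) l₁ g₁ V g₁<l₁ (proj₁ (length≡+⇒drop l₁ _ V |V|))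
    (∈-skewFilling-row t l₁ (l₂ ∷ []) 0 (0 ∷ []) g₁ (g₂ ∷ []) V)
overfullRow-trailingZeros t l₁ l₂ [] [] g₁ g₂ [] V [] (inj₂ g₂<l₂) |V| =
  overfullRow (suc (suc t)) (suc (suc t) + 0) l₂ g₂ (drop l₁ V) g₂<l₂
    (subst (l₂ ≤_) (sym (proj₂ (length≡+⇒drop l₁ (l₂ + 0) V |V|))) (ℕP.m≤m+n l₂ 0))
    (∈-skewFilling-below t l₁ (l₂ ∷ []) 0 (0 ∷ []) g₁ (g₂ ∷ []) V ∘ ∈-skewFilling-row (suc t) l₂ [] 0 [] g₂ [] (drop l₁ V))
overfullRow-trailingZeros t l₁ l₂ (l₃ ∷ la) (_ ∷ μ) g₁ g₂ (g₃ ∷ f) V (refl ∷ zeros) lastTwo |V| =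
  OverfullRow-mono (∈-skewFilling-below t l₁ (l₂ ∷ l₃ ∷ la) 0 (0 ∷ 0 ∷ μ) g₁ (g₂ ∷ g₃ ∷ f) V)
    (overfullRow-trailingZeros (suc t) l₂ l₃ la μ g₂ g₃ f (drop l₁ V) zeros lastTwo
       (proj₂ (length≡+⇒drop l₁ _ V |V|)))

paddedStrict-¬decreasing : ∀ {r} a b (μ : Vec ℕ r) → paddedStrictᵇ (toList (a ∷ b ∷ μ)) ≡ true → a ≤ b → a ≡ 0 × b ≡ 0
paddedStrict-¬decreasing a b μ strict a≤b =
  let (a≡0 , b≡0) = ∧≡true⇒ (subst (λ x → (x ∨ ((a ≡ᵇ 0) ∧ (b ≡ᵇ 0))) ≡ true) (≥⇒<ᵇ≡false a≤b) (proj₁ (∧≡true⇒ strict)))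
  in ≡ᵇ≡true⇒≡ a≡0 , ≡ᵇ≡true⇒≡ b≡0

overfullRow-step : ∀ {r} t l l₂ (la : Vec ℕ r) a b μ g g₂ f V →
  paddedStrictᵇ (toList (a ∷ b ∷ μ)) ≡ true → isPartitionᵇ (toList (barFrom t (a ∷ b ∷ μ))) ≡ false →
  LastTwo (l ∷ l₂ ∷ la) (g ∷ g₂ ∷ f) → length V ≡ skewSize (l ∷ l₂ ∷ la) (a ∷ b ∷ μ) →
  (isPartitionᵇ (toList (barFrom (suc t) (b ∷ μ))) ≡ false → OverfullRow (skewFilling (suc t) (l₂ ∷ la) (b ∷ μ) (g₂ ∷ f) (drop (l ∸ a) V))) →
  OverfullRow (skewFilling t (l ∷ l₂ ∷ la) (a ∷ b ∷ μ) (g ∷ g₂ ∷ f) V)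
overfullRow-step t l l₂ la a b μ g g₂ f V strict ¬partition lastTwo |V| laterRows
  with (b + suc t) ≤ᵇ (a + t) in barDecreasing
... | true = OverfullRow-mono (∈-skewFilling-below t l (l₂ ∷ la) a (b ∷ μ) g (g₂ ∷ f) V) (laterRows ¬partition)
... | false with paddedStrict-¬decreasing a b μ strict a≤b
  where
  a≤b : a ≤ b
  a≤b = ℕP.+-cancelʳ-≤ t a b (ℕP.≤-pred (subst (suc (a + t) ≤_) (ℕP.+-suc b t)
          (ℕP.≰⇒> (λ le → true≢false (trans (sym (≤⇒≤ᵇ≡true le)) barDecreasing)))))
...   | refl , refl =
  overfullRow-trailingZeros t l l₂ la μ g g₂ f V (paddedStrict-0∷⇒zeros μ strict) lastTwo |V|

overfullRow-¬partition : ∀ {r} t (la μ f : Vec ℕ r) V → paddedStrictᵇ (toList μ) ≡ true → isPartitionᵇ (toList (barFrom t μ)) ≡ false →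
  LastTwo la f → length V ≡ skewSize la μ → OverfullRow (skewFilling t la μ f V)
overfullRow-¬partition t (l ∷ l₂ ∷ []) (a ∷ b ∷ []) (g ∷ g₂ ∷ []) V strict ¬partition lastTwo |V| =
  overfullRow-step t l l₂ [] a b [] g g₂ [] V strict ¬partition lastTwo |V| (λ ())
overfullRow-¬partition t (l ∷ l₂ ∷ l₃ ∷ la) (a ∷ b ∷ c ∷ μ) (g ∷ g₂ ∷ g₃ ∷ f) V strict ¬partition lastTwo |V| =
  overfullRow-step t l l₂ (l₃ ∷ la) a b (c ∷ μ) g g₂ (g₃ ∷ f) V strict ¬partition lastTwo |V|
    (λ ¬partition′ → overfullRow-¬partition (suc t) (l₂ ∷ l₃ ∷ la) (b ∷ c ∷ μ) (g₂ ∷ g₃ ∷ f) (drop (l ∸ a) V)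
       (paddedStrict-tail a (b ∷ c ∷ μ) strict) ¬partition′ lastTwo (proj₂ (length≡+⇒drop (l ∸ a) _ V |V|)))

sstPairOK-sameRow : ∀ i s g e j′ g′ e′ → s < j′ → sstPairOK ((i , s , g) , e) ((i , j′ , g′) , e′) ≡ true → e < e′
sstPairOK-sameRow i s g e j′ g′ e′ s<j′ ok rewrite ≡ᵇ-refl i | <⇒<ᵇ≡true s<j′ = <ᵇ≡true⇒< (proj₁ (∧≡true⇒ ok))

strictRow-length≤ : ∀ i s m g (W : List ℕ) lo → m ≤ length W →
  (∀ {p} → p ∈ zip (rowCells i s m g) W → sstRowOK p ≡ true) →
  (∀ {p q} → p ∈ zip (rowCells i s m g) W → q ∈ zip (rowCells i s m g) W → sstPairOK p q ≡ true) →
  (∀ {p} → p ∈ zip (rowCells i s m g) W → lo < proj₂ p) → m ≤ g ∸ lo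
strictRow-length≤ i s zero g W lo _ _ _ _ = z≤n
strictRow-length≤ i s (suc m) g (e ∷ W) lo (s≤s m≤W) rowOK pairOK lo< =
  ℕP.≤-trans (s≤s rest≤) (ℕP.≤-trans (ℕP.≤-reflexive (sym (ℕP.+-∸-assoc 1 e≤g))) (ℕP.∸-monoʳ-≤ (suc g) (lo< (here refl))))
  where
  e≤g : e ≤ g
  e≤g = ≤ᵇ≡true⇒≤ (proj₂ (∧≡true⇒ (rowOK (here refl))))
  e<later : ∀ {q} → q ∈ zip (rowCells i (suc s) m g) W → e < proj₂ q
  e<later {(i′ , j′ , g′) , e′} q∈ with All.lookup (All-zip⁺ (All-rowCells i (suc s) m g) (All.universal (λ _ → tt) W)) q∈
  ... | (refl , s<j′ , _) , _ = sstPairOK-sameRow i s g e j′ g′ e′ s<j′ (pairOK (here refl) (there q∈))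
  rest≤ : m ≤ g ∸ e
  rest≤ = strictRow-length≤ i (suc s) m g W e m≤W (rowOK ∘ there) (λ p∈ q∈ → pairOK (there p∈) (there q∈)) e<later

isSST⇒¬OverfullRow : ∀ T → isSST T ≡ true → OverfullRow T → ⊥
isSST⇒¬OverfullRow T sst (overfullRow i s m g W g<m m≤W ⊆T) =
  ℕP.<⇒≱ g<m (strictRow-length≤ i s m g W 0 m≤W rowOK
    (λ p∈ q∈ → all≡true⇒∈ T (all≡true⇒∈ T (proj₂ (∧≡true⇒ sst)) (⊆T p∈)) (⊆T q∈))
    (λ {p} p∈ → ≤ᵇ≡true⇒≤ {1} {proj₂ p} (proj₁ (∧≡true⇒ (rowOK p∈)))))
  where
  rowOK : ∀ {p} → p ∈ zip (rowCells i s m g) W → sstRowOK p ≡ true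
  rowOK p∈ = all≡true⇒∈ T (proj₁ (∧≡true⇒ sst)) (⊆T p∈)

isSST-¬partition : ∀ {r} (la μ f : Vec ℕ r) V → paddedStrictᵇ (toList μ) ≡ true → isPartitionᵇ (toList (bar μ)) ≡ false →
  LastTwo la f → length V ≡ skewSize la μ → isSST (skewFilling 0 la μ f V) ≡ false
isSST-¬partition la μ f V strict ¬partition lastTwo |V| with isSST (skewFilling 0 la μ f V) in sst
... | true = ⊥-elim (isSST⇒¬OverfullRow _ sst (overfullRow-¬partition 0 la μ f V strict ¬partition lastTwo |V|))
... | false = refl

∧-rearrange : ∀ a b c d → (a ∧ ((b ∧ c) ∧ d)) ≡ ((b ∧ (a ∧ d)) ∧ c)
∧-rearrange a false c d = ∧-zeroʳ a
∧-rearrange true true c d = ∧-comm c d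
∧-rearrange false true c d = refl

isMST-mergedFilling : ∀ {r} (la μ f : Vec ℕ r) U V → Pointwise _≤_ μ la → length U ≡ Vec.sum μ → length V ≡ skewSize la μ →
  All (1 ≤_) V →
  isMST (mergedFilling 0 la μ f U V) ≡
  ((isMST (plainFilling 0 μ (Vec.replicate r 0) U) ∧ isSST (skewFilling 0 la μ f V)) ∧
   crossOK 0 la μ f U V)
isMST-mergedFilling {r} la μ f U V μ≤la |U| |V| positive =
  trans (isMST-interleaving (mergedFilling-interleaving 0 la μ f U V μ≤la |U| |V|))
    (trans (cong₂ (λ a c → (a ∧ all mstRowOK C) ∧ ((pairsOK M M ∧ pairsOK C M) ∧ (c ∧ pairsOK C C)))
                  (all-mstRowOK-plain plainCells U) (pairsOK-plain-circ plainCells skewCells′ U V))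
      (trans (∧-rearrange (all mstRowOK C) (pairsOK M M) (pairsOK C M) (pairsOK C C))
        (cong₂ (λ a c → (a ∧ c) ∧ pairsOK C M) plainPairs
               (trans (cong isMST (zip-map₂ circ skewCells′ V)) (isMST-circ (zip skewCells′ V) (All-zip⁺ʳ skewCells′ positive))))))
  where
  plainCells = shiftedCells μ f
  skewCells′ = skewCells (bar la) (bar μ) f
  M = plainFilling 0 μ f U
  C = circledFilling 0 la μ f V
  M₀ = plainFilling 0 μ (Vec.replicate r 0) U
  plainPairs : pairsOK M M ≡ isMST M₀
  plainPairs = trans (pairsOK-positions plainCells (shiftedCells μ (Vec.replicate r 0)) (map plainEntry U)
                                        (positions-shiftedCells 1 μ f (Vec.replicate r 0)))
                     (cong (_∧ pairsOK M₀ M₀) (sym (all-mstRowOK-plain (shiftedCells μ (Vec.replicate r 0)) U)))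

guarded-∧ : ∀ st pa m s P → (st ≡ true → P ≡ true) → (st ≡ false → P ≡ false) → (st ≡ true → pa ≡ false → s ≡ false) →
            ((m ∧ s) ∧ P) ≡ ((st ∧ pa) ∧ (m ∧ s))
guarded-∧ true true m s P P-true _ _ rewrite P-true refl = ∧-identityʳ (m ∧ s)
guarded-∧ true false m s P _ _ s-false rewrite s-false refl refl = cong (_∧ P) (∧-zeroʳ m)
guarded-∧ false pa m s P _ P-false _ rewrite P-false refl = ∧-zeroʳ (m ∧ s)

isMST-mergedFilling-admissible : ∀ {r} (la μ f : Vec ℕ r) U V → StrictPartition (toList la) → LastTwo la f →
  Pointwise _≤_ μ la → length U ≡ Vec.sum μ → length V ≡ skewSize la μ → All (1 ≤_) V →
  isMST (mergedFilling 0 la μ f U V) ≡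
  ((paddedStrictᵇ (toList μ) ∧ isPartitionᵇ (toList (bar μ))) ∧
   (isMST (plainFilling 0 μ (Vec.replicate r 0) U) ∧ isSST (skewFilling 0 la μ f V)))
isMST-mergedFilling-admissible {r} la μ f U V strictλ lastTwo μ≤la |U| |V| positive =
  trans (isMST-mergedFilling la μ f U V μ≤la |U| |V| positive)
        (guarded-∧ (paddedStrictᵇ (toList μ)) (isPartitionᵇ (toList (bar μ)))
                   (isMST (plainFilling 0 μ (Vec.replicate r 0) U)) (isSST (skewFilling 0 la μ f V))
                   (crossOK 0 la μ f U V)
                   (crossOK-strict 0 la μ f U V)
                   (crossOK-nonstrict 0 la μ f U V strictλ μ≤la |U| |V|)
                   (λ strict ¬partition → isSST-¬partition la μ f V strict ¬partition lastTwo |V|))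

module _ {X Y : Set} where
  HasInj₁ : List (X ⊎ Y) → Set
  HasInj₁ [] = ⊥
  HasInj₁ (inj₁ _ ∷ w) = ⊤
  HasInj₁ (inj₂ _ ∷ w) = HasInj₁ w

  Unsorted : List (X ⊎ Y) → Set
  Unsorted [] = ⊥
  Unsorted (inj₁ _ ∷ w) = Unsorted w
  Unsorted (inj₂ _ ∷ w) = HasInj₁ w

  sortedWord : List X → List Y → List (X ⊎ Y)
  sortedWord u v = map inj₁ u ++ map inj₂ v

∈-zip-rowCells-plain : ∀ i s m g w → HasInj₁ w → length w ≡ m →
  ∃ λ j′ → ∃ λ y → s ≤ j′ × ((i , j′ , g) , plainEntry y) ∈ zip (rowCells i s m g) (map entry w)
∈-zip-rowCells-plain i s (suc m) g (inj₁ y ∷ w) _ _ = s , y , ℕP.≤-refl , here refl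
∈-zip-rowCells-plain i s (suc m) g (inj₂ _ ∷ w) hasPlain |w|
  with ∈-zip-rowCells-plain i (suc s) m g w hasPlain (ℕP.suc-injective |w|)
... | j′ , y , s<j′ , y∈ = j′ , y , ℕP.≤-trans (ℕP.n≤1+n s) s<j′ , there y∈

unsortedRow-clash : ∀ i s m g w → Unsorted w → length w ≡ m →
  ∃ λ p → ∃ λ q → p ∈ zip (rowCells i s m g) (map entry w) × q ∈ zip (rowCells i s m g) (map entry w) × mstPairOK p q ≡ false
unsortedRow-clash i s (suc m) g (inj₁ _ ∷ w) unsorted |w|
  with unsortedRow-clash i (suc s) m g w unsorted (ℕP.suc-injective |w|)
... | p , q , p∈ , q∈ , clash = p , q , there p∈ , there q∈ , clash
unsortedRow-clash i s (suc m) g (inj₂ e ∷ w) hasPlain |w|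
  with ∈-zip-rowCells-plain i (suc s) m g w hasPlain (ℕP.suc-injective |w|)
... | j′ , y , s<j′ , y∈ = _ , _ , here refl , there y∈ , mstPairOK-circ-left-of-plain i s g j′ g e y s<j′

plainLetters : ℕ → List (ℕ ⊎ ℕ)
plainLetters n = map inj₁ (range 1 n) ++ map inj₂ (range 1 n)

plainEntries : ∀ n → map plainEntry (plainLetters n) ≡ map unm (range 1 n) ++ map pr (range 1 n)
plainEntries n = trans (map-++ plainEntry (map inj₁ (range 1 n)) _)
                       (cong₂ _++_ (sym (map-∘ (range 1 n))) (sym (map-∘ (range 1 n))))

alphabet-sortedWord : ∀ n F → alphabet n F ≡ map entry (sortedWord (plainLetters n) (range 1 F))
alphabet-sortedWord n F = sym (trans (map-++ entry (map inj₁ (plainLetters n)) _)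
  (trans (cong₂ _++_ (trans (sym (map-∘ (plainLetters n))) (plainEntries n)) (sym (map-∘ (range 1 F))))
         (++-assoc (map unm (range 1 n)) (map pr (range 1 n)) _)))

alphabet-0 : ∀ n → alphabet n 0 ≡ map plainEntry (plainLetters n)
alphabet-0 n = trans (cong (map unm (range 1 n) ++_) (++-identityʳ (map pr (range 1 n)))) (sym (plainEntries n))

All-allWords-length : ∀ {A : Set} (al : List A) m → All (λ w → length w ≡ m) (allWords al m)
All-allWords-length al zero = refl ∷ []
All-allWords-length al (suc m) =
  Allₚ.concat⁺ (Allₚ.map⁺ (All.universal (λ a → Allₚ.map⁺ (All.map (cong suc) (All-allWords-length al m))) al))

All-allWords : ∀ {A : Set} {P : A → Set} (al : List A) m → All P al → All (All P) (allWords al m)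
All-allWords al zero _ = [] ∷ []
All-allWords al (suc m) Pal =
  Allₚ.concat⁺ (Allₚ.map⁺ (All.map (λ Pa → Allₚ.map⁺ (All.map (Pa ∷_) (All-allWords al m Pal))) Pal))

All-boundedVecs : ∀ {r} (la : Vec ℕ r) → All (λ μ → Pointwise _≤_ μ la) (boundedVecs la)
All-boundedVecs [] = [] ∷ []
All-boundedVecs (l ∷ la) =
  Allₚ.concat⁺ (Allₚ.map⁺ (All.map (λ (_ , a<) → Allₚ.map⁺ (All.map (ℕP.≤-pred a< ∷_) (All-boundedVecs la)))
                                   (All-range 0 (suc l))))

module Sums {c ℓ} (R : CommutativeRing c ℓ) where
  open Poly R using (sumL; prodL)
  open CommutativeRing R renaming (_+_ to _⊕_; _*_ to _⊗_; refl to ≈-refl; sym to ≈-sym; trans to ≈-trans)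
  open import Algebra.Properties.CommutativeSemigroup +-commutativeSemigroup using (interchange)
  open import Algebra.Properties.CommutativeSemigroup *-commutativeSemigroup using (x∙yz≈y∙xz)
  open import Relation.Binary.Reasoning.Setoid setoid

  sumOver : ∀ {A : Set} → List A → (A → Carrier) → Carrier
  sumOver xs F = sumL (map F xs)

  sumOver-cong : ∀ {A : Set} (xs : List A) {F G : A → Carrier} → (∀ x → F x ≈ G x) → sumOver xs F ≈ sumOver xs G
  sumOver-cong [] e = ≈-refl
  sumOver-cong (x ∷ xs) e = +-cong (e x) (sumOver-cong xs e)

  sumOver-cong-All : ∀ {A : Set} {P : A → Set} {xs : List A} {F G : A → Carrier} → All P xs →
                     (∀ {x} → P x → F x ≈ G x) → sumOver xs F ≈ sumOver xs G
  sumOver-cong-All [] e = ≈-refl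
  sumOver-cong-All (px ∷ pxs) e = +-cong (e px) (sumOver-cong-All pxs e)

  sumOver-++ : ∀ {A : Set} (xs ys : List A) (F : A → Carrier) → sumOver (xs ++ ys) F ≈ sumOver xs F ⊕ sumOver ys F
  sumOver-++ [] ys F = ≈-sym (+-identityˡ _)
  sumOver-++ (x ∷ xs) ys F = ≈-trans (+-cong ≈-refl (sumOver-++ xs ys F)) (≈-sym (+-assoc _ _ _))

  sumOver-map : ∀ {A B : Set} (h : A → B) (xs : List A) (F : B → Carrier) → sumOver (map h xs) F ≈ sumOver xs (F ∘ h)
  sumOver-map h [] F = ≈-refl
  sumOver-map h (x ∷ xs) F = +-cong ≈-refl (sumOver-map h xs F)

  sumOver-concatMap : ∀ {A B : Set} (g : A → List B) (xs : List A) (F : B → Carrier) →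
                      sumOver (concatMap g xs) F ≈ sumOver xs (λ a → sumOver (g a) F)
  sumOver-concatMap g [] F = ≈-refl
  sumOver-concatMap g (x ∷ xs) F = ≈-trans (sumOver-++ (g x) (concatMap g xs) F) (+-cong ≈-refl (sumOver-concatMap g xs F))

  sumOver-0# : ∀ {A : Set} (xs : List A) → sumOver xs (λ _ → 0#) ≈ 0#
  sumOver-0# [] = ≈-refl
  sumOver-0# (x ∷ xs) = ≈-trans (+-identityˡ _) (sumOver-0# xs)

  sumOver-≈0# : ∀ {A : Set} (xs : List A) {F : A → Carrier} → (∀ x → F x ≈ 0#) → sumOver xs F ≈ 0#
  sumOver-≈0# xs e = ≈-trans (sumOver-cong xs e) (sumOver-0# xs)

  sumOver-⊕ : ∀ {A : Set} (xs : List A) (F G : A → Carrier) → sumOver xs (λ x → F x ⊕ G x) ≈ sumOver xs F ⊕ sumOver xs G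
  sumOver-⊕ [] F G = ≈-sym (+-identityˡ _)
  sumOver-⊕ (x ∷ xs) F G = ≈-trans (+-cong ≈-refl (sumOver-⊕ xs F G)) (interchange _ _ _ _)

  sumOver-*ˡ : ∀ {A : Set} (k : Carrier) (xs : List A) (F : A → Carrier) → k ⊗ sumOver xs F ≈ sumOver xs (λ x → k ⊗ F x)
  sumOver-*ˡ k [] F = zeroʳ k
  sumOver-*ˡ k (x ∷ xs) F = ≈-trans (distribˡ k _ _) (+-cong ≈-refl (sumOver-*ˡ k xs F))

  sumOver-*ʳ : ∀ {A : Set} (k : Carrier) (xs : List A) (F : A → Carrier) → sumOver xs F ⊗ k ≈ sumOver xs (λ x → F x ⊗ k)
  sumOver-*ʳ k [] F = zeroˡ k
  sumOver-*ʳ k (x ∷ xs) F = ≈-trans (distribʳ k _ _) (+-cong ≈-refl (sumOver-*ʳ k xs F))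

  sumOver-product : ∀ {A B : Set} (xs : List A) (ys : List B) (F : A → Carrier) (G : B → Carrier) →
                    sumOver xs (λ u → sumOver ys (λ v → F u ⊗ G v)) ≈ sumOver xs F ⊗ sumOver ys G
  sumOver-product xs ys F G = begin
    sumOver xs (λ u → sumOver ys (λ v → F u ⊗ G v)) ≈⟨ sumOver-cong xs (λ u → ≈-sym (sumOver-*ˡ (F u) ys G)) ⟩
    sumOver xs (λ u → F u ⊗ sumOver ys G)            ≈⟨ ≈-sym (sumOver-*ʳ (sumOver ys G) xs F) ⟩
    sumOver xs F ⊗ sumOver ys G                      ∎

  sumOver-swap : ∀ {A B : Set} (xs : List A) (ys : List B) (F : A → B → Carrier) →
                 sumOver xs (λ a → sumOver ys (F a)) ≈ sumOver ys (λ b → sumOver xs (λ a → F a b))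
  sumOver-swap [] ys F = ≈-sym (sumOver-0# ys)
  sumOver-swap (x ∷ xs) ys F = ≈-trans (+-cong ≈-refl (sumOver-swap xs ys F)) (≈-sym (sumOver-⊕ ys (F x) _))

  sumOver-range-suc : ∀ s m (F : ℕ → Carrier) → sumOver (range (suc s) m) F ≈ sumOver (range s m) (F ∘ suc)
  sumOver-range-suc s zero F = ≈-refl
  sumOver-range-suc s (suc m) F = +-cong ≈-refl (sumOver-range-suc (suc s) m F)

  sumOver-allWords-suc : ∀ {A : Set} (al : List A) m (F : List A → Carrier) →
    sumOver (allWords al (suc m)) F ≈ sumOver al (λ a → sumOver (allWords al m) (λ w → F (a ∷ w)))
  sumOver-allWords-suc al m F = ≈-trans (sumOver-concatMap (λ a → map (a ∷_) (allWords al m)) al F) (sumOver-cong al (λ a → sumOver-map (a ∷_) (allWords al m) F))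

  sumOver-allWords-+ : ∀ {A : Set} (al : List A) m k (F : List A → Carrier) →
    sumOver (allWords al (m + k)) F ≈ sumOver (allWords al m) (λ u → sumOver (allWords al k) (λ v → F (u ++ v)))
  sumOver-allWords-+ al zero k F = ≈-sym (+-identityʳ _)
  sumOver-allWords-+ al (suc m) k F = begin
    sumOver (allWords al (suc (m + k))) F
      ≈⟨ sumOver-allWords-suc al (m + k) F ⟩
    sumOver al (λ a → sumOver (allWords al (m + k)) (λ w → F (a ∷ w)))
      ≈⟨ sumOver-cong al (λ a → sumOver-allWords-+ al m k (λ w → F (a ∷ w))) ⟩
    sumOver al (λ a → sumOver (allWords al m) (λ u → sumOver (allWords al k) (λ v → F (a ∷ u ++ v))))
      ≈⟨ ≈-sym (sumOver-allWords-suc al m _) ⟩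
    sumOver (allWords al (suc m)) (λ u → sumOver (allWords al k) (λ v → F (u ++ v))) ∎

  sumOver-allWords-map : ∀ {A B : Set} (h : A → B) (al : List A) m (F : List B → Carrier) →
    sumOver (allWords (map h al) m) F ≈ sumOver (allWords al m) (F ∘ map h)
  sumOver-allWords-map h al zero F = ≈-refl
  sumOver-allWords-map h al (suc m) F = begin
    sumOver (allWords (map h al) (suc m)) F
      ≈⟨ sumOver-allWords-suc (map h al) m F ⟩
    sumOver (map h al) (λ a → sumOver (allWords (map h al) m) (λ w → F (a ∷ w)))
      ≈⟨ sumOver-map h al _ ⟩
    sumOver al (λ a → sumOver (allWords (map h al) m) (λ w → F (h a ∷ w)))
      ≈⟨ sumOver-cong al (λ a → sumOver-allWords-map h al m (λ w → F (h a ∷ w))) ⟩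
    sumOver al (λ a → sumOver (allWords al m) (λ w → F (h a ∷ map h w)))
      ≈⟨ ≈-sym (sumOver-allWords-suc al m _) ⟩
    sumOver (allWords al (suc m)) (F ∘ map h) ∎

  sumOver-allWords-cong : ∀ {A : Set} (al : List A) m {F G : List A → Carrier} →
    (∀ w → length w ≡ m → F w ≈ G w) → sumOver (allWords al m) F ≈ sumOver (allWords al m) G
  sumOver-allWords-cong al m e = sumOver-cong-All (All-allWords-length al m) (λ {w} → e w)

  sumOver-boundedVecs-∷ : ∀ {r} l (la : Vec ℕ r) (G : Vec ℕ (suc r) → Carrier) →
    sumOver (boundedVecs (l ∷ la)) G ≈ sumOver (range 0 (suc l)) (λ a → sumOver (boundedVecs la) (λ μ → G (a ∷ μ)))
  sumOver-boundedVecs-∷ l la G =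
    ≈-trans (sumOver-concatMap (λ a → map (a ∷_) (boundedVecs la)) (range 0 (suc l)) G) (sumOver-cong (range 0 (suc l)) (λ a → sumOver-map (a ∷_) (boundedVecs la) G))

  module TwoAlphabets {X Y : Set} (A : List X) (B : List Y) where
    alphabet⊎ : List (X ⊎ Y)
    alphabet⊎ = map inj₁ A ++ map inj₂ B

    sumOver-alphabet⊎ : ∀ (F : X ⊎ Y → Carrier) → sumOver alphabet⊎ F ≈ sumOver A (F ∘ inj₁) ⊕ sumOver B (F ∘ inj₂)
    sumOver-alphabet⊎ F = ≈-trans (sumOver-++ (map inj₁ A) (map inj₂ B) F) (+-cong (sumOver-map inj₁ A F) (sumOver-map inj₂ B F))

    sumOver-words-noInj₁ : ∀ l (H : List (X ⊎ Y) → Carrier) → (∀ w → length w ≡ l → HasInj₁ w → H w ≈ 0#) →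
      sumOver (allWords alphabet⊎ l) H ≈ sumOver (allWords B l) (H ∘ map inj₂)
    sumOver-words-noInj₁ zero H vanish = ≈-refl
    sumOver-words-noInj₁ (suc l) H vanish = begin
      sumOver (allWords alphabet⊎ (suc l)) H
        ≈⟨ sumOver-allWords-suc alphabet⊎ l H ⟩
      sumOver alphabet⊎ (λ c → sumOver (allWords alphabet⊎ l) (λ w → H (c ∷ w)))
        ≈⟨ sumOver-alphabet⊎ _ ⟩
      sumOver A (λ x → sumOver (allWords alphabet⊎ l) (λ w → H (inj₁ x ∷ w))) ⊕
      sumOver B (λ y → sumOver (allWords alphabet⊎ l) (λ w → H (inj₂ y ∷ w)))
        ≈⟨ +-cong (sumOver-≈0# A (λ x → ≈-trans
                     (sumOver-allWords-cong alphabet⊎ l (λ w |w| → vanish (inj₁ x ∷ w) (cong suc |w|) _))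
                     (sumOver-0# (allWords alphabet⊎ l))))
                  (sumOver-cong B (λ y → sumOver-words-noInj₁ l (λ w → H (inj₂ y ∷ w))
                     (λ w |w| hasInj₁ → vanish (inj₂ y ∷ w) (cong suc |w|) hasInj₁))) ⟩
      0# ⊕ sumOver B (λ y → sumOver (allWords B l) (λ v → H (inj₂ y ∷ map inj₂ v)))
        ≈⟨ +-identityˡ _ ⟩
      sumOver B (λ y → sumOver (allWords B l) (λ v → H (inj₂ y ∷ map inj₂ v)))
        ≈⟨ ≈-sym (sumOver-allWords-suc B l _) ⟩
      sumOver (allWords B (suc l)) (H ∘ map inj₂) ∎

    sumOverSorted : ℕ → (List (X ⊎ Y) → Carrier) → Carrier
    sumOverSorted l H =
      sumOver (range 0 (suc l)) (λ a → sumOver (allWords A a) (λ u → sumOver (allWords B (l ∸ a)) (λ v → H (sortedWord u v))))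

    sumOver-words-sorted : ∀ l (H : List (X ⊎ Y) → Carrier) → (∀ w → length w ≡ l → Unsorted w → H w ≈ 0#) →
      sumOver (allWords alphabet⊎ l) H ≈ sumOverSorted l H
    sumOver-words-sorted zero H vanish = ≈-sym (+-cong (≈-trans (+-identityʳ _) (+-identityʳ _)) ≈-refl)
    sumOver-words-sorted (suc l) H vanish = begin
      sumOver (allWords alphabet⊎ (suc l)) H                                    ≈⟨ sumOver-allWords-suc alphabet⊎ l H ⟩
      sumOver alphabet⊎ (λ c → sumOver (allWords alphabet⊎ l) (λ w → H (c ∷ w))) ≈⟨ sumOver-alphabet⊎ _ ⟩
      startsInA ⊕ startsInB                                                     ≈⟨ +-comm _ _ ⟩
      startsInB ⊕ startsInA                                                     ≈⟨ +-cong startsInB≈ startsInA≈ ⟩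
      sortedWith 0 ⊕ sumOver (range 1 (suc l)) sortedWith                        ∎
      where
      startsInA = sumOver A (λ x → sumOver (allWords alphabet⊎ l) (λ w → H (inj₁ x ∷ w)))
      startsInB = sumOver B (λ y → sumOver (allWords alphabet⊎ l) (λ w → H (inj₂ y ∷ w)))
      sortedWith : ℕ → Carrier
      sortedWith a = sumOver (allWords A a) (λ u → sumOver (allWords B (suc l ∸ a)) (λ v → H (sortedWord u v)))
      startsInB≈ : startsInB ≈ sortedWith 0
      startsInB≈ = begin
        startsInB
          ≈⟨ sumOver-cong B (λ y → sumOver-words-noInj₁ l (λ w → H (inj₂ y ∷ w))
               (λ w |w| hasInj₁ → vanish (inj₂ y ∷ w) (cong suc |w|) hasInj₁)) ⟩
        sumOver B (λ y → sumOver (allWords B l) (λ v → H (inj₂ y ∷ map inj₂ v))) ≈⟨ ≈-sym (sumOver-allWords-suc B l _) ⟩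
        sumOver (allWords B (suc l)) (H ∘ map inj₂)                              ≈⟨ ≈-sym (+-identityʳ _) ⟩
        sortedWith 0 ∎
      startsInA≈ : startsInA ≈ sumOver (range 1 (suc l)) sortedWith
      startsInA≈ = begin
        startsInA
          ≈⟨ sumOver-cong A (λ x → sumOver-words-sorted l (λ w → H (inj₁ x ∷ w))
               (λ w |w| unsorted → vanish (inj₁ x ∷ w) (cong suc |w|) unsorted)) ⟩
        sumOver A (λ x → sumOverSorted l (λ w → H (inj₁ x ∷ w)))
          ≈⟨ sumOver-swap A (range 0 (suc l)) _ ⟩
        sumOver (range 0 (suc l)) (λ a → sumOver A (λ x → sumOver (allWords A a) (λ u →
          sumOver (allWords B (l ∸ a)) (λ v → H (inj₁ x ∷ sortedWord u v)))))
          ≈⟨ sumOver-cong (range 0 (suc l)) (λ a → ≈-sym (sumOver-allWords-suc A a _)) ⟩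
        sumOver (range 0 (suc l)) (sortedWith ∘ suc) ≈⟨ ≈-sym (sumOver-range-suc 0 (suc l) sortedWith) ⟩
        sumOver (range 1 (suc l)) sortedWith ∎

    sumOverRows : ∀ {r} → Vec ℕ r → (List (X ⊎ Y) → Carrier) → Carrier
    sumOverRows [] H = H []
    sumOverRows (l ∷ la) H = sumOver (allWords alphabet⊎ l) (λ w₁ → sumOverRows la (λ w → H (w₁ ++ w)))

    sumOverRows-≈0# : ∀ {r} (la : Vec ℕ r) {H : List (X ⊎ Y) → Carrier} → (∀ w → H w ≈ 0#) → sumOverRows la H ≈ 0#
    sumOverRows-≈0# [] vanish = vanish []
    sumOverRows-≈0# (l ∷ la) vanish = sumOver-≈0# (allWords alphabet⊎ l) (λ w₁ → sumOverRows-≈0# la (λ w → vanish (w₁ ++ w)))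

    sumOver-allWords-rows : ∀ {r} (la : Vec ℕ r) H → sumOver (allWords alphabet⊎ (Vec.sum la)) H ≈ sumOverRows la H
    sumOver-allWords-rows [] H = +-identityʳ _
    sumOver-allWords-rows (l ∷ la) H =
      ≈-trans (sumOver-allWords-+ alphabet⊎ l (Vec.sum la) H)
              (sumOver-cong (allWords alphabet⊎ l) (λ w₁ → sumOver-allWords-rows la (λ w → H (w₁ ++ w))))

    RowsSorted : ∀ {r} → Vec ℕ r → (List (X ⊎ Y) → Carrier) → Set ℓ
    RowsSorted [] H = ⊤ℓ.⊤
    RowsSorted (l ∷ la) H = (∀ w₁ w → length w₁ ≡ l → Unsorted w₁ → H (w₁ ++ w) ≈ 0#) ×
                            (∀ w₁ → length w₁ ≡ l → RowsSorted la (λ w → H (w₁ ++ w)))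

    RowsSorted-cong : ∀ {r} (la : Vec ℕ r) {H H′ : List (X ⊎ Y) → Carrier} → (∀ w → H w ≈ H′ w) → RowsSorted la H → RowsSorted la H′
    RowsSorted-cong [] e _ = ⊤ℓ.tt
    RowsSorted-cong (l ∷ la) e (firstRow , laterRows) =
      (λ w₁ w |w₁| unsorted → ≈-trans (≈-sym (e (w₁ ++ w))) (firstRow w₁ w |w₁| unsorted)) ,
      (λ w₁ |w₁| → RowsSorted-cong la (λ w → e (w₁ ++ w)) (laterRows w₁ |w₁|))

    sumOverSortedRows : ∀ {r} → Vec ℕ r → Vec ℕ r → (List (X ⊎ Y) → Carrier) → Carrier
    sumOverSortedRows [] [] H = H []
    sumOverSortedRows (l ∷ la) (a ∷ μ) H =
      sumOver (allWords A a) (λ u → sumOver (allWords B (l ∸ a)) (λ v → sumOverSortedRows la μ (λ w → H (sortedWord u v ++ w))))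

    length-sortedWord : ∀ (u : List X) (v : List Y) {a l} → length u ≡ a → length v ≡ l ∸ a → a ≤ l →
                        length (sortedWord u v) ≡ l
    length-sortedWord u v |u| |v| a≤l = trans (length-++ (map inj₁ u))
      (trans (cong₂ _+_ (trans (length-map inj₁ u) |u|) (trans (length-map inj₂ v) |v|)) (ℕP.m+[n∸m]≡n a≤l))

    sumOverRows-sorted : ∀ {r} (la : Vec ℕ r) H → RowsSorted la H →
                         sumOverRows la H ≈ sumOver (boundedVecs la) (λ μ → sumOverSortedRows la μ H)
    sumOverRows-sorted [] H _ = ≈-sym (+-identityʳ _)
    sumOverRows-sorted (l ∷ la) H (firstRow , laterRows) = begin
      sumOver (allWords alphabet⊎ l) (λ w₁ → sumOverRows la (λ w → H (w₁ ++ w)))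
        ≈⟨ sumOver-words-sorted l _ (λ w₁ |w₁| unsorted → sumOverRows-≈0# la (λ w → firstRow w₁ w |w₁| unsorted)) ⟩
      sumOver (range 0 (suc l)) (λ a → sumOver (allWords A a) (λ u → sumOver (allWords B (l ∸ a)) (λ v →
        sumOverRows la (λ w → H (sortedWord u v ++ w)))))
        ≈⟨ sumOver-cong-All (All-range 0 (suc l)) (λ {a} (_ , a<) →
             sumOver-allWords-cong A a (λ u |u| → sumOver-allWords-cong B (l ∸ a) (λ v |v| →
               sumOverRows-sorted la _ (laterRows _ (length-sortedWord u v |u| |v| (ℕP.≤-pred a<)))))) ⟩
      sumOver (range 0 (suc l)) (λ a → sumOver (allWords A a) (λ u → sumOver (allWords B (l ∸ a)) (λ v →
        sumOver (boundedVecs la) (λ μ → sumOverSortedRows la μ (λ w → H (sortedWord u v ++ w))))))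
        ≈⟨ sumOver-cong (range 0 (suc l)) (λ a → ≈-trans
             (sumOver-cong (allWords A a) (λ u → sumOver-swap (allWords B (l ∸ a)) (boundedVecs la) _))
             (sumOver-swap (allWords A a) (boundedVecs la) _)) ⟩
      sumOver (range 0 (suc l)) (λ a → sumOver (boundedVecs la) (λ μ → sumOverSortedRows (l ∷ la) (a ∷ μ) H))
        ≈⟨ ≈-sym (sumOver-boundedVecs-∷ l la _) ⟩
      sumOver (boundedVecs (l ∷ la)) (λ μ → sumOverSortedRows (l ∷ la) μ H) ∎

    sumOverSortedRows-merge : ∀ {r} (la μ : Vec ℕ r) H → sumOverSortedRows la μ H ≈
      sumOver (allWords A (Vec.sum μ)) (λ U → sumOver (allWords B (skewSize la μ)) (λ V → H (rowwiseMerge la μ U V)))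
    sumOverSortedRows-merge [] [] H = ≈-sym (≈-trans (+-identityʳ _) (+-identityʳ _))
    sumOverSortedRows-merge (l ∷ la) (a ∷ μ) H = begin
      sumOver (allWords A a) (λ u → sumOver (allWords B (l ∸ a)) (λ v →
        sumOverSortedRows la μ (λ w → H (sortedWord u v ++ w))))
        ≈⟨ sumOver-cong (allWords A a) (λ u → sumOver-cong (allWords B (l ∸ a)) (λ v → sumOverSortedRows-merge la μ _)) ⟩
      sumOver (allWords A a) (λ u → sumOver (allWords B (l ∸ a)) (λ v →
        sumOver (allWords A (Vec.sum μ)) (λ U → sumOver (allWords B (skewSize la μ)) (λ V →
          H (sortedWord u v ++ rowwiseMerge la μ U V)))))
        ≈⟨ sumOver-cong (allWords A a) (λ u → sumOver-swap (allWords B (l ∸ a)) (allWords A (Vec.sum μ)) _) ⟩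
      sumOver (allWords A a) (λ u → sumOver (allWords A (Vec.sum μ)) (λ U → sumOver (allWords B (l ∸ a)) (λ v →
        sumOver (allWords B (skewSize la μ)) (λ V → H (sortedWord u v ++ rowwiseMerge la μ U V)))))
        ≈⟨ sumOver-allWords-cong A a (λ u |u| → sumOver-allWords-cong A (Vec.sum μ) (λ U _ →
             sumOver-allWords-cong B (l ∸ a) (λ v |v| → sumOver-cong (allWords B (skewSize la μ)) (λ V →
               reflexive (cong H (sym (rowwiseMerge-++ u U v V |u| |v|))))))) ⟩
      sumOver (allWords A a) (λ u → sumOver (allWords A (Vec.sum μ)) (λ U → sumOver (allWords B (l ∸ a)) (λ v →
        sumOver (allWords B (skewSize la μ)) (λ V → H (rowwiseMerge (l ∷ la) (a ∷ μ) (u ++ U) (v ++ V))))))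
        ≈⟨ sumOver-cong (allWords A a) (λ u → sumOver-cong (allWords A (Vec.sum μ)) (λ U →
             ≈-sym (sumOver-allWords-+ B (l ∸ a) (skewSize la μ) _))) ⟩
      sumOver (allWords A a) (λ u → sumOver (allWords A (Vec.sum μ)) (λ U →
        sumOver (allWords B (skewSize (l ∷ la) (a ∷ μ))) (λ V → H (rowwiseMerge (l ∷ la) (a ∷ μ) (u ++ U) V))))
        ≈⟨ ≈-sym (sumOver-allWords-+ A a (Vec.sum μ) _) ⟩
      sumOver (allWords A (Vec.sum (a ∷ μ))) (λ U → sumOver (allWords B (skewSize (l ∷ la) (a ∷ μ))) (λ V →
        H (rowwiseMerge (l ∷ la) (a ∷ μ) U V))) ∎
      where
      rowwiseMerge-++ : ∀ u U v V → length u ≡ a → length v ≡ l ∸ a →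
                        rowwiseMerge (l ∷ la) (a ∷ μ) (u ++ U) (v ++ V) ≡ sortedWord u v ++ rowwiseMerge la μ U V
      rowwiseMerge-++ u U v V |u| |v| rewrite take-++ u U |u| | drop-++ u U |u| | take-++ v V |v| | drop-++ v V |v| = refl

  prodL-interleaving : ∀ {A : Set} (w : A → Carrier) {M S T : List A} → Interleaving M S T →
                       prodL (map w T) ≈ prodL (map w M) ⊗ prodL (map w S)
  prodL-interleaving w [] = ≈-sym (*-identityˡ _)
  prodL-interleaving w (consˡ i) = ≈-trans (*-cong ≈-refl (prodL-interleaving w i)) (≈-sym (*-assoc _ _ _))
  prodL-interleaving w (consʳ i) = ≈-trans (*-cong ≈-refl (prodL-interleaving w i)) (x∙yz≈y∙xz _ _ _)

  if-cong : ∀ c {X X′ : Carrier} → X ≈ X′ → (if c then X else 0#) ≈ (if c then X′ else 0#)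
  if-cong true e = e
  if-cong false e = ≈-refl

  if-∧-⊗ : ∀ a m s (X Y : Carrier) →
           (if a ∧ (m ∧ s) then X ⊗ Y else 0#) ≈ (if a then (if m then X else 0#) ⊗ (if s then Y else 0#) else 0#)
  if-∧-⊗ false m s X Y = ≈-refl
  if-∧-⊗ true true true X Y = ≈-refl
  if-∧-⊗ true true false X Y = ≈-sym (zeroʳ _)
  if-∧-⊗ true false s X Y = ≈-sym (zeroˡ _)

  sumOver-if : ∀ {A B : Set} c (xs : List A) (ys : List B) (F : A → Carrier) (G : B → Carrier) →
    sumOver xs (λ u → sumOver ys (λ v → if c then F u ⊗ G v else 0#)) ≈ (if c then sumOver xs F ⊗ sumOver ys G else 0#)
  sumOver-if false xs ys F G = sumOver-≈0# xs (λ u → sumOver-0# ys)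
  sumOver-if true xs ys F G = sumOver-product xs ys F G

sum-replicate-0 : ∀ r → Vec.sum (Vec.replicate r 0) ≡ 0
sum-replicate-0 zero = refl
sum-replicate-0 (suc r) = sum-replicate-0 r

module Expansion {c ℓ} (R : CommutativeRing c ℓ) (n : ℕ) (x z b : ℕ → CommutativeRing.Carrier R) {r} (la f : Vec ℕ r) where
  open CommutativeRing R renaming (_+_ to _⊕_; _*_ to _⊗_; refl to ≈-refl; sym to ≈-sym; trans to ≈-trans)
  open Poly R
  open Sums R
  open TwoAlphabets (plainLetters n) (range 1 (Vec.sum f))
  open import Relation.Binary.Reasoning.Setoid setoid

  mstTerm : (ℕ → Carrier) → Filling → Carrier
  mstTerm z′ T = if isMST T then prodL (map (mstWeight x z′ b) T) else 0#

  sstWeight : Cell × ℕ → Carrier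
  sstWeight ((i , j , _) , e) = z e ⊕ bZ b ((ℤ.+ e) ℤ.+ (ℤ.+ i) ℤ.- (ℤ.+ j))

  sstTerm : SFilling → Carrier
  sstTerm T = if isSST T then prodL (map sstWeight T) else 0#

  wordTerm : List ((ℕ ⊎ ℕ) ⊎ ℕ) → Carrier
  wordTerm W = mstTerm z (zip (shiftedCells la f) (map entry W))

  plainTerm : Vec ℕ r → List (ℕ ⊎ ℕ) → Carrier
  plainTerm μ U = mstTerm (λ _ → 0#) (plainFilling 0 μ (Vec.replicate r 0) U)

  skewTerm : Vec ℕ r → List ℕ → Carrier
  skewTerm μ V = sstTerm (skewFilling 0 la μ f V)

  weights-plain : ∀ z′ z″ (cs cs′ : List Cell) U → map position cs ≡ map position cs′ →
    map (mstWeight x z′ b) (zip cs (map plainEntry U)) ≡ map (mstWeight x z″ b) (zip cs′ (map plainEntry U))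
  weights-plain z′ z″ [] [] U _ = refl
  weights-plain z′ z″ (c ∷ cs) (c′ ∷ cs′) [] _ = refl
  weights-plain z′ z″ ((i , j , _) ∷ cs) ((i′ , j′ , _) ∷ cs′) (y ∷ U) e =
    cong₂ _∷_ (weight (∷-injectiveˡ e) y) (weights-plain z′ z″ cs cs′ U (∷-injectiveʳ e))
    where
    weight : (i , j) ≡ (i′ , j′) → ∀ y → mstWeight x z′ b ((i , j , _) , plainEntry y) ≡ mstWeight x z″ b ((i′ , j′ , _) , plainEntry y)
    weight refl (inj₁ _) = refl
    weight refl (inj₂ _) = refl

  weights-circ : ∀ (cs : List Cell) V → map (mstWeight x z b) (zip cs (map circ V)) ≡ map sstWeight (zip cs V)
  weights-circ cs V = trans (cong (map (mstWeight x z b)) (zip-map₂ circ cs V)) (sym (map-∘ (zip cs V)))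

  mstTerm-false : ∀ z′ T → isMST T ≡ false → mstTerm z′ T ≈ 0#
  mstTerm-false z′ T e rewrite e = ≈-refl

  wordTerm-merge : StrictPartition (toList la) → LastTwo la f → ∀ μ U V → Pointwise _≤_ μ la →
    length U ≡ Vec.sum μ → length V ≡ skewSize la μ → All (1 ≤_) V →
    wordTerm (rowwiseMerge la μ U V) ≈ (if admissibleμ μ then plainTerm μ U ⊗ skewTerm μ V else 0#)
  wordTerm-merge strictλ lastTwo μ U V μ≤la |U| |V| positive = begin
    wordTerm (rowwiseMerge la μ U V)
      ≡⟨ cong (λ c → if c then prodL (map (mstWeight x z b) merged) else 0#)
              (isMST-mergedFilling-admissible la μ f U V strictλ lastTwo μ≤la |U| |V| positive) ⟩
    (if admissibleμ μ ∧ (isMST M₀ ∧ isSST S) then prodL (map (mstWeight x z b) merged) else 0#)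
      ≈⟨ if-cong (admissibleμ μ ∧ (isMST M₀ ∧ isSST S)) weights ⟩
    (if admissibleμ μ ∧ (isMST M₀ ∧ isSST S) then prodL (map (mstWeight x (λ _ → 0#) b) M₀) ⊗ prodL (map sstWeight S) else 0#)
      ≈⟨ if-∧-⊗ (admissibleμ μ) (isMST M₀) (isSST S) _ _ ⟩
    (if admissibleμ μ then plainTerm μ U ⊗ skewTerm μ V else 0#) ∎
    where
    merged = mergedFilling 0 la μ f U V
    M₀ = plainFilling 0 μ (Vec.replicate r 0) U
    S = skewFilling 0 la μ f V
    weights : prodL (map (mstWeight x z b) merged) ≈ prodL (map (mstWeight x (λ _ → 0#) b) M₀) ⊗ prodL (map sstWeight S)
    weights = ≈-trans (prodL-interleaving (mstWeight x z b) (mergedFilling-interleaving 0 la μ f U V μ≤la |U| |V|))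
      (reflexive (cong₂ (λ p q → prodL p ⊗ prodL q)
        (weights-plain z (λ _ → 0#) (shiftedCells μ f) (shiftedCells μ (Vec.replicate r 0)) U
                       (positions-shiftedCells 1 μ f (Vec.replicate r 0)))
        (weights-circ (skewCells (bar la) (bar μ) f) V)))

  Qμ-words : ∀ μ → Qμ n x b μ ≈ sumOver (allWords (plainLetters n) (Vec.sum μ)) (plainTerm μ)
  Qμ-words μ = begin
    Qμ n x b μ
      ≈⟨ sumOver-map (zip cells) (allWords (alphabet n (Vec.sum (Vec.replicate r 0))) (length cells)) (mstTerm (λ _ → 0#)) ⟩
    sumOver (allWords (alphabet n (Vec.sum (Vec.replicate r 0))) (length cells)) (mstTerm (λ _ → 0#) ∘ zip cells)
      ≡⟨ cong (λ al → sumOver (allWords al (length cells)) (mstTerm (λ _ → 0#) ∘ zip cells))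
              (trans (cong (alphabet n) (sum-replicate-0 r)) (alphabet-0 n)) ⟩
    sumOver (allWords (map plainEntry (plainLetters n)) (length cells)) (mstTerm (λ _ → 0#) ∘ zip cells)
      ≈⟨ sumOver-allWords-map plainEntry (plainLetters n) (length cells) _ ⟩
    sumOver (allWords (plainLetters n) (length cells)) (plainTerm μ)
      ≡⟨ cong (λ m → sumOver (allWords (plainLetters n) m) (plainTerm μ)) (length-shiftedCells 1 μ (Vec.replicate r 0)) ⟩
    sumOver (allWords (plainLetters n) (Vec.sum μ)) (plainTerm μ) ∎
    where
    cells = shiftedCells μ (Vec.replicate r 0)

  sTildeStar-words : ∀ μ → sTildeStar z b (bar la) (bar μ) f ≈ sumOver (allWords (range 1 (Vec.sum f)) (skewSize la μ)) (skewTerm μ)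
  sTildeStar-words μ = ≈-trans (sumOver-map (zip cells) (allWords (range 1 (Vec.sum f)) (length cells)) sstTerm)
    (reflexive (cong (λ m → sumOver (allWords (range 1 (Vec.sum f)) m) (skewTerm μ)) (length-skewCells 0 la μ f)))
    where
    cells = skewCells (bar la) (bar μ) f

  sumOverSortedRows-wordTerm : StrictPartition (toList la) → LastTwo la f → ∀ μ → Pointwise _≤_ μ la →
    sumOverSortedRows la μ wordTerm ≈ (if admissibleμ μ then Qμ n x b μ ⊗ sTildeStar z b (bar la) (bar μ) f else 0#)
  sumOverSortedRows-wordTerm strictλ lastTwo μ μ≤la = begin
    sumOverSortedRows la μ wordTerm
      ≈⟨ sumOverSortedRows-merge la μ wordTerm ⟩
    sumOver (allWords A (Vec.sum μ)) (λ U → sumOver (allWords B (skewSize la μ)) (λ V → wordTerm (rowwiseMerge la μ U V)))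
      ≈⟨ sumOver-allWords-cong A (Vec.sum μ) (λ U |U| →
           sumOver-cong-All (All.zip (All-allWords-length B (skewSize la μ) , All-allWords B (skewSize la μ) (All.map proj₁ (All-range 1 (Vec.sum f)))))
             (λ (|V| , positive) → wordTerm-merge strictλ lastTwo μ U _ μ≤la |U| |V| positive)) ⟩
    sumOver (allWords A (Vec.sum μ)) (λ U → sumOver (allWords B (skewSize la μ)) (λ V →
      if admissibleμ μ then plainTerm μ U ⊗ skewTerm μ V else 0#))
      ≈⟨ sumOver-if (admissibleμ μ) (allWords A (Vec.sum μ)) (allWords B (skewSize la μ)) (plainTerm μ) (skewTerm μ) ⟩
    (if admissibleμ μ then sumOver (allWords A (Vec.sum μ)) (plainTerm μ) ⊗ sumOver (allWords B (skewSize la μ)) (skewTerm μ) else 0#)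
      ≈⟨ if-cong (admissibleμ μ) (*-cong (≈-sym (Qμ-words μ)) (≈-sym (sTildeStar-words μ))) ⟩
    (if admissibleμ μ then Qμ n x b μ ⊗ sTildeStar z b (bar la) (bar μ) f else 0#) ∎
    where
    A = plainLetters n
    B = range 1 (Vec.sum f)

  rowsSorted-mstTerm : ∀ {r′} t (la′ f′ : Vec ℕ r′) (prefix : Filling) →
    RowsSorted la′ (λ w → mstTerm z (prefix ++ zip (shiftedCellsFrom (suc t) la′ f′) (map entry w)))
  rowsSorted-mstTerm t [] [] prefix = ⊤ℓ.tt
  rowsSorted-mstTerm t (l ∷ la′) (g ∷ f′) prefix = unsortedRow-vanishes , laterRows
    where
    firstRow = rowCells (suc t) (suc t) l g
    below = shiftedCellsFrom (suc (suc t)) la′ f′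
    split : ∀ w₁ w → length w₁ ≡ l → zip (firstRow ++ below) (map entry (w₁ ++ w)) ≡ zip firstRow (map entry w₁) ++ zip below (map entry w)
    split w₁ w |w₁| = trans (cong (zip (firstRow ++ below)) (map-++ entry w₁ w))
      (zip-++ firstRow below (map entry w₁) (map entry w) (trans (length-rowCells (suc t) (suc t) l g) (sym (trans (length-map entry w₁) |w₁|))))
    unsortedRow-vanishes : ∀ w₁ w → length w₁ ≡ l → Unsorted w₁ →
      mstTerm z (prefix ++ zip (firstRow ++ below) (map entry (w₁ ++ w))) ≈ 0#
    unsortedRow-vanishes w₁ w |w₁| unsorted with unsortedRow-clash (suc t) (suc t) l g w₁ unsorted |w₁|
    ... | p , q , p∈ , q∈ , clash =
      mstTerm-false z filling (∈⇒isMST≡false filling (inFilling p∈) (inFilling q∈) clash)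
      where
      filling = prefix ++ zip (firstRow ++ below) (map entry (w₁ ++ w))
      inFilling : ∀ {p} → p ∈ zip firstRow (map entry w₁) → p ∈ filling
      inFilling p∈ = subst (λ L → _ ∈ (prefix ++ L)) (sym (split w₁ w |w₁|)) (∈-++⁺ʳ prefix (∈-++⁺ˡ p∈))
    laterRows : ∀ w₁ → length w₁ ≡ l →
      RowsSorted la′ (λ w → mstTerm z (prefix ++ zip (firstRow ++ below) (map entry (w₁ ++ w))))
    laterRows w₁ |w₁| = RowsSorted-cong la′
      (λ w → reflexive (cong (mstTerm z) (trans (++-assoc prefix _ _) (cong (prefix ++_) (sym (split w₁ w |w₁|))))))
      (rowsSorted-mstTerm (suc t) la′ f′ (prefix ++ zip firstRow (map entry w₁)))

proposition3p9 : ∀ {c ℓ} (R : CommutativeRing c ℓ) (n r : ℕ) (la f : Vec ℕ r)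
    → StrictPartition (toList la)
    → LastTwo la f
    → (x z b : ℕ → CommutativeRing.Carrier R)
    → CommutativeRing._≈_ R (Poly.Qλf R n x z b la f) (Poly.expansion R n x z b la f)
proposition3p9 R n r la f strictλ lastTwo x z b = begin
  Qλf n x z b la f
    ≈⟨ sumOver-map (zip cells) (allWords (alphabet n (Vec.sum f)) (length cells)) (mstTerm z) ⟩
  sumOver (allWords (alphabet n (Vec.sum f)) (length cells)) (mstTerm z ∘ zip cells)
    ≡⟨ cong₂ (λ al m → sumOver (allWords al m) (mstTerm z ∘ zip cells))
             (alphabet-sortedWord n (Vec.sum f)) (length-shiftedCells 1 la f) ⟩
  sumOver (allWords (map entry alphabet⊎) (Vec.sum la)) (mstTerm z ∘ zip cells)
    ≈⟨ sumOver-allWords-map entry alphabet⊎ (Vec.sum la) _ ⟩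
  sumOver (allWords alphabet⊎ (Vec.sum la)) wordTerm
    ≈⟨ sumOver-allWords-rows la wordTerm ⟩
  sumOverRows la wordTerm
    ≈⟨ sumOverRows-sorted la wordTerm (rowsSorted-mstTerm 0 la f []) ⟩
  sumOver (boundedVecs la) (λ μ → sumOverSortedRows la μ wordTerm)
    ≈⟨ sumOver-cong-All (All-boundedVecs la) (sumOverSortedRows-wordTerm strictλ lastTwo _) ⟩
  expansion n x z b la f ∎
  where
  open CommutativeRing R using (setoid)
  open import Relation.Binary.Reasoning.Setoid setoid
  open Poly R
  open Sums R
  open Expansion R n x z b la f
  open TwoAlphabets (plainLetters n) (range 1 (Vec.sum f))
  cells = shiftedCells la f
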